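{- Let $\Gamma$ be a distance-regular graph with classical parameters $(D, b, \alpha, \beta)$ and diameter $D \geq 3$. Then $\theta = -1 + \frac{b_1}{b}$ is an eigenvalue of $\Gamma$ of classical $b$-type. In particular, the $b$-distance matrix $\mathbb{D}_b$ of $\Gamma$ has exactly three distinct eigenvalues, one of which is $0$.
   Context: A connected graph $\Gamma$ of diameter $D$ is distance-regular if for all vertices $x,y$ at distance $h$ the number $p^h_{ij}$ of vertices $z$ with $d(x,z)=i$, $d(y,z)=j$ depends only on $h,i,j$. Write $c_i = p^i_{1,i-1}$, $a_i = p^i_{1,i}$, $b_i = p^i_{1,i+1}$, $k=b_0$. Let $[j]_b = 1+b+\cdots+b^{j-1}$ for $j\ge1$ and $[0]_b=0$. $\Gamma$ has classical parameters $(D,b,\alpha,\beta)$ if $c_i = [i]_b\,(1+\alpha[i-1]_b)$ and $b_i = ([D]_b-[i]_b)(\beta-\alpha[i]_b)$ for all $i$ (here $b$ is a nonzero integer, $b\neq -1$). The standard sequence $(u_i)_{i=0}^D$ of an eigenvalue $\theta$ is defined by $u_0=1$, $u_1=\theta/k$, and $c_iu_{i-1}+a_iu_i+b_iu_{i+1}=\theta u_i$ for $1\le i\le D-1$. The eigenvalue $\theta\ne k$ is of classical $q$-type if there is a real $c$ with $u_i = \frac1q u_{i-1}+c$ for $i=1,\dots,D$. The $q$-distance matrix $\mathbb{D}_q$ has zero diagonal and $(\mathbb{D}_q)_{xy} = 1 + \frac{1}{q} + \cdots + \frac{1}{q^{d(x,y)-1}}$ for $x \neq y$.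
   Formalization: The classical parameters α and β range over the rationals. -}

module Defs where

open import Data.Bool using (Bool; true; false; if_then_else_; _∧_)
open import Data.Nat as ℕ using (ℕ; zero; suc; _∸_; _≤_; _<_; _≡ᵇ_)
open import Data.Integer as ℤ using (ℤ; +_; -[1+_])
open import Data.Rational as ℚ using (ℚ; _/_; 0ℚ; 1ℚ)
open import Data.Fin using (Fin; _≟_)
open import Data.List using (List; foldr; map; allFin)
open import Data.Bool.ListAction using (any)
open import Data.Sum using (_⊎_)
open import Data.Product using (Σ; ∃; _×_; _,_)
open import Relation.Binary.PropositionalEquality using (_≡_; _≢_)
open import Relation.Nullary.Decidable using (⌊_⌋)

record Graph (n : ℕ) : Set where
  field
    adj    : Fin n → Fin n → Bool
    sym    : ∀ x y → adj x y ≡ adj y x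
    irrefl : ∀ x → adj x x ≡ false

module _ {n : ℕ} (G : Graph n) where
  open Graph G

  walk : ℕ → Fin n → Fin n → Bool
  walk zero    x y = ⌊ x ≟ y ⌋
  walk (suc k) x y = any (λ z → adj x z ∧ walk k z y) (allFin n)

  Connected : Set
  Connected = ∀ x y → ∃ λ k → walk k x y ≡ true

-- least index m < bound with f m = true (returns bound if none)
firstTrue : ℕ → (ℕ → Bool) → ℕ
firstTrue zero    f = zero
firstTrue (suc b) f = if f zero then zero else suc (firstTrue b (λ m → f (suc m)))

-- graph distance: the least length of a walk from x to y
-- (correct for connected graphs, where it is < n)
dist : {n : ℕ} → Graph n → Fin n → Fin n → ℕ
dist {n} G x y = firstTrue n (λ k → walk G k x y)

count : {n : ℕ} → (Fin n → Bool) → ℕ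
count {n} f = foldr (λ z acc → if f z then suc acc else acc) zero (allFin n)

HasDiameter : {n : ℕ} → Graph n → ℕ → Set
HasDiameter {n} G D =
  (∀ x y → dist G x y ≤ D) × (Σ (Fin n) λ x → Σ (Fin n) λ y → dist G x y ≡ D)

IntersectionNumbers : {n : ℕ} → Graph n → (ℕ → ℕ → ℕ → ℕ) → Set
IntersectionNumbers {n} G p =
  ∀ (x y : Fin n) (i j : ℕ) →
    count (λ z → (dist G x z ≡ᵇ i) ∧ (dist G y z ≡ᵇ j)) ≡ p (dist G x y) i j

record DRG (n : ℕ) : Set where
  field
    graph     : Graph n
    connected : Connected graph
    p         : ℕ → ℕ → ℕ → ℕ
    isDR      : IntersectionNumbers graph p

  c : ℕ → ℕ
  c i = p i 1 (i ∸ 1)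
  a : ℕ → ℕ
  a i = p i 1 i
  b : ℕ → ℕ
  b i = p i 1 (suc i)
  k : ℕ
  k = b 0

ℕ→ℚ : ℕ → ℚ
ℕ→ℚ m = + m / 1

ℤ→ℚ : ℤ → ℚ
ℤ→ℚ z = z / 1

-- 1/z for an integer z (convention 1/0 = 0; only used for z ≠ 0)
recipℤ : ℤ → ℚ
recipℤ (+ zero)  = 0ℚ
recipℤ (+ suc m) = + 1 / suc m
recipℤ -[1+ m ]  = -[1+ 0 ] / suc m

-- q / m for a natural m (convention q/0 = 0; only used for m ≠ 0)
_/ℕ_ : ℚ → ℕ → ℚ
q /ℕ zero  = 0ℚ
q /ℕ suc m = q ℚ.* (+ 1 / suc m)

-- q-bracket [j]_q = 1 + q + ... + q^{j-1}, [0]_q = 0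
bracket : ℚ → ℕ → ℚ
bracket q zero    = 0ℚ
bracket q (suc j) = 1ℚ ℚ.+ q ℚ.* bracket q j

Σv : {n : ℕ} → (Fin n → ℚ) → ℚ
Σv {n} f = foldr (λ z acc → f z ℚ.+ acc) 0ℚ (allFin n)

ClassicalParameters : {n : ℕ} → DRG n → ℕ → ℤ → ℚ → ℚ → Set
ClassicalParameters Γ D q α β =
  (q ≢ + 0) × (q ≢ -[1+ 0 ]) ×
  (∀ i → i ≤ D →
     (ℕ→ℚ (DRG.c Γ i) ≡ bracket (ℤ→ℚ q) i ℚ.* (1ℚ ℚ.+ α ℚ.* bracket (ℤ→ℚ q) (i ∸ 1)))
   × (ℕ→ℚ (DRG.b Γ i) ≡
        (bracket (ℤ→ℚ q) D ℚ.- bracket (ℤ→ℚ q) i) ℚ.* (β ℚ.- α ℚ.* bracket (ℤ→ℚ q) i)))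

IsEigenvalue : {n : ℕ} → (Fin n → Fin n → ℚ) → ℚ → Set
IsEigenvalue {n} M λ′ =
  Σ (Fin n → ℚ) λ v → (Σ (Fin n) λ x → v x ≢ 0ℚ) ×
    (∀ x → Σv (λ y → M x y ℚ.* v y) ≡ λ′ ℚ.* v x)

adjMatrix : {n : ℕ} → Graph n → Fin n → Fin n → ℚ
adjMatrix G x y = if Graph.adj G x y then 1ℚ else 0ℚ

stdSeq : {n : ℕ} → DRG n → ℚ → ℕ → ℚ
stdSeq Γ θ zero = 1ℚ
stdSeq Γ θ (suc zero) = θ /ℕ DRG.k Γ
stdSeq Γ θ (suc (suc i)) =
  (θ ℚ.* stdSeq Γ θ (suc i)
     ℚ.- ℕ→ℚ (DRG.c Γ (suc i)) ℚ.* stdSeq Γ θ i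
     ℚ.- ℕ→ℚ (DRG.a Γ (suc i)) ℚ.* stdSeq Γ θ (suc i)) /ℕ DRG.b Γ (suc i)

ClassicalType : {n : ℕ} → DRG n → ℕ → ℤ → ℚ → Set
ClassicalType Γ D q θ =
  IsEigenvalue (adjMatrix (DRG.graph Γ)) θ × (θ ≢ ℕ→ℚ (DRG.k Γ)) ×
  (Σ ℚ λ c → ∀ i → 1 ≤ i → i ≤ D →
     stdSeq Γ θ i ≡ recipℤ q ℚ.* stdSeq Γ θ (i ∸ 1) ℚ.+ c)

qDistMatrix : {n : ℕ} → Graph n → ℤ → Fin n → Fin n → ℚ
qDistMatrix G q x y = bracket (recipℤ q) (dist G x y)

-- M has exactly three distinct eigenvalues, one of which is 0:
-- 0, λ, μ are pairwise distinct eigenvalues, every rational eigenvalue is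
-- one of them, and ℚ^n is spanned by eigenvectors for 0, λ, μ
-- (so no further eigenvalues exist over any extension field).
ExactlyThreeEigenvaluesOneZero : {n : ℕ} → (Fin n → Fin n → ℚ) → Set
ExactlyThreeEigenvaluesOneZero {n} M =
  Σ ℚ λ λ′ → Σ ℚ λ μ →
    (λ′ ≢ 0ℚ) × (μ ≢ 0ℚ) × (λ′ ≢ μ) ×
    IsEigenvalue M 0ℚ × IsEigenvalue M λ′ × IsEigenvalue M μ ×
    (∀ ν → IsEigenvalue M ν → (ν ≡ 0ℚ) ⊎ ((ν ≡ λ′) ⊎ (ν ≡ μ))) ×
    (∀ (w : Fin n → ℚ) → Σ (Fin n → ℚ) λ w₀ → Σ (Fin n → ℚ) λ w₁ → Σ (Fin n → ℚ) λ w₂ →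
       (∀ x → w x ≡ w₀ x ℚ.+ (w₁ x ℚ.+ w₂ x)) ×
       (∀ x → Σv (λ y → M x y ℚ.* w₀ y) ≡ 0ℚ ℚ.* w₀ x) ×
       (∀ x → Σv (λ y → M x y ℚ.* w₁ y) ≡ λ′ ℚ.* w₁ x) ×
       (∀ x → Σv (λ y → M x y ℚ.* w₂ y) ≡ μ ℚ.* w₂ x))

-- Let u be the standard sequence of θ = −1 + b₁/b and e = u₁ − 1. Writing bⱼ₊₁ through the classical
-- parameters as k bʲ⁺¹ + k e b [j+1] + b cⱼ₊₁ and feeding it into the three-term recurrence shows by
-- induction that (uⱼ₊₁ − uⱼ) bʲ = e, so θ is of classical b-type; the same identity at j = D − 1, where
-- b_D = 0, says that the recurrence closes, i.e. x ↦ u (d y x) is a θ-eigenvector of A.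
-- An eigenvector for θ is determined on each sphere around x by its value at x, so M = (u (d x y)) acts
-- as a scalar κ ≥ 1 on the θ-eigenspace; as it contains the columns of M, M² = κ M, and M has zero row sums
-- because θ ≠ k. Finally [i]_{1/b} e = uᵢ − 1 gives 𝔻_b = e⁻¹ (M − J), whose only eigenvalues are then
-- 0, e⁻¹ κ and −e⁻¹ n.

module Submission where

open import Defs
open import Data.Bool using (Bool; true; false; if_then_else_; _∧_; T)
open import Data.Bool.Properties using (T-≡; T-∧)
open import Data.Bool.ListAction using (any)
open import Data.Nat as ℕ using (ℕ; zero; suc; _≤_; _<_; _∸_; _≡ᵇ_; z≤n; s≤s)
import Data.Nat.Properties as ℕP
open import Data.Nat.Coprimality using (1-coprimeTo) renaming (sym to coprime-sym)
open import Data.Integer as ℤ using (ℤ; +_; -[1+_])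
import Data.Integer.Properties as ℤP
open import Data.Rational as ℚ using (ℚ; mkℚ; 0ℚ; 1ℚ; _+_; _*_; -_; _-_; 1/_)
import Data.Rational.Properties as ℚP
import Data.Rational.Unnormalised as ℚᵘ
import Data.Rational.Unnormalised.Properties as ℚᵘP
open import Data.Rational.Solver using (module +-*-Solver)
open import Data.Fin using (Fin; _≟_) renaming (zero to fzero; suc to fsuc)
open import Data.Fin.Properties using (¬Fin0)
open import Data.List using (List; []; _∷_; foldr; map; allFin)
import Data.List.Properties as ListP
open import Data.List.Membership.Propositional using (_∈_; lose)
open import Data.List.Membership.Propositional.Properties using (∈-allFin)
open import Data.List.Relation.Unary.Any using (here; there; satisfied)
open import Data.List.Relation.Unary.Any.Properties using (any⁺; any⁻)
open import Data.Product using (Σ; ∃; _×_; _,_; proj₁; proj₂)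
open import Data.Sum using (_⊎_; inj₁; inj₂; [_,_]′)
open import Data.Empty using (⊥; ⊥-elim)
open import Function using (_∘_)
open import Function.Bundles using (Equivalence)
open import Relation.Nullary using (yes; no)
open import Relation.Nullary.Decidable using (⌊_⌋; toWitness; fromWitness)
open import Relation.Binary.PropositionalEquality hiding ([_])
open import Relation.Binary.Definitions using (tri<; tri≈; tri>)

open +-*-Solver

-- ℕ→ℚ m = + m / 1 normalises to mkℚ (+ m) 0 _, on which toℚᵘ is a homomorphism.
private
  fromℕ : ℕ → ℚ
  fromℕ m = mkℚ (+ m) 0 (coprime-sym (1-coprimeTo m))

  ℕ→ℚ≡fromℕ : ∀ m → ℕ→ℚ m ≡ fromℕ m
  ℕ→ℚ≡fromℕ m = ℚP.normalize-coprime (coprime-sym (1-coprimeTo m))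

  1/suc≡1/fromℕ : ∀ m → + 1 ℚ./ suc m ≡ 1/ fromℕ (suc m)
  1/suc≡1/fromℕ m = ℚP.normalize-coprime (1-coprimeTo (suc m))

ℕ→ℚ-+ : ∀ m l → ℕ→ℚ (m ℕ.+ l) ≡ ℕ→ℚ m + ℕ→ℚ l
ℕ→ℚ-+ m l rewrite ℕ→ℚ≡fromℕ (m ℕ.+ l) | ℕ→ℚ≡fromℕ m | ℕ→ℚ≡fromℕ l =
  ℚP.toℚᵘ-injective (ℚᵘP.≃-trans (ℚᵘ.*≡* eq) (ℚᵘP.≃-sym (ℚP.toℚᵘ-homo-+ (fromℕ m) (fromℕ l))))
  where
  eq : + (m ℕ.+ l) ℤ.* + 1 ≡ (+ m ℤ.* + 1 ℤ.+ + l ℤ.* + 1) ℤ.* + 1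
  eq rewrite ℤP.*-identityʳ (+ m) | ℤP.*-identityʳ (+ l) = refl

ℕ→ℚ-* : ∀ m l → ℕ→ℚ (m ℕ.* l) ≡ ℕ→ℚ m * ℕ→ℚ l
ℕ→ℚ-* m l rewrite ℕ→ℚ≡fromℕ (m ℕ.* l) | ℕ→ℚ≡fromℕ m | ℕ→ℚ≡fromℕ l =
  ℚP.toℚᵘ-injective (ℚᵘP.≃-trans (ℚᵘ.*≡* (cong (ℤ._* + 1) (ℤP.pos-* m l)))
                                  (ℚᵘP.≃-sym (ℚP.toℚᵘ-homo-* (fromℕ m) (fromℕ l))))

ℕ→ℚ-injective : ∀ {m l} → ℕ→ℚ m ≡ ℕ→ℚ l → m ≡ l
ℕ→ℚ-injective {m} {l} e rewrite ℕ→ℚ≡fromℕ m | ℕ→ℚ≡fromℕ l = ℤP.+-injective (cong ℚ.↥_ e)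

ℕ→ℚ-≢0 : ∀ {m} → m ≢ 0 → ℕ→ℚ m ≢ 0ℚ
ℕ→ℚ-≢0 m≢0 e = m≢0 (ℕ→ℚ-injective e)

ℕ→ℚ-nonNeg : ∀ m → 0ℚ ℚ.≤ ℕ→ℚ m
ℕ→ℚ-nonNeg m rewrite ℕ→ℚ≡fromℕ m = ℚP.nonNegative⁻¹ (fromℕ m)

nonNeg-* : ∀ {a b} → 0ℚ ℚ.≤ a → 0ℚ ℚ.≤ b → 0ℚ ℚ.≤ a * b
nonNeg-* {a} {b} 0≤a 0≤b =
  ℚP.nonNegative⁻¹ (a * b) {{ℚP.nonNeg*nonNeg⇒nonNeg a {{ℚ.nonNegative 0≤a}} b {{ℚ.nonNegative 0≤b}}}}

square-nonNeg : ∀ a → 0ℚ ℚ.≤ a * a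
square-nonNeg a with ℚP.≤-total 0ℚ a
... | inj₁ 0≤a = nonNeg-* 0≤a 0≤a
... | inj₂ a≤0 = ℚP.nonNegative⁻¹ (a * a) {{ℚP.nonPos*nonPos⇒nonPos a {{ℚ.nonPositive a≤0}} a {{ℚ.nonPositive a≤0}}}}

ℕ→ℚ-*-/ℕ : ∀ m q → m ≢ 0 → ℕ→ℚ m * (q /ℕ m) ≡ q
ℕ→ℚ-*-/ℕ zero    q m≢0 = ⊥-elim (m≢0 refl)
ℕ→ℚ-*-/ℕ (suc m) q _ rewrite ℕ→ℚ≡fromℕ (suc m) | 1/suc≡1/fromℕ m = begin
  a * (q * 1/ a)  ≡⟨ solve 3 (λ a q a⁻¹ → a :* (q :* a⁻¹) := q :* (a :* a⁻¹)) refl a q (1/ a) ⟩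
  q * (a * 1/ a)  ≡⟨ cong (q *_) (ℚP.*-inverseʳ a) ⟩
  q * 1ℚ          ≡⟨ ℚP.*-identityʳ q ⟩
  q               ∎
  where open ≡-Reasoning
        a = fromℕ (suc m)

recipℤ-inverseˡ : ∀ z → z ≢ + 0 → recipℤ z * ℤ→ℚ z ≡ 1ℚ
recipℤ-inverseˡ (+ zero)  z≢0 = ⊥-elim (z≢0 refl)
recipℤ-inverseˡ (+ suc m) _ rewrite ℕ→ℚ≡fromℕ (suc m) | 1/suc≡1/fromℕ m = ℚP.*-inverseˡ (fromℕ (suc m))
recipℤ-inverseˡ -[1+ m ]  _ rewrite ℕ→ℚ≡fromℕ (suc m) | 1/suc≡1/fromℕ m = begin
  (- 1/ a) * (- a)  ≡⟨ solve 2 (λ a⁻¹ a → (:- a⁻¹) :* (:- a) := a⁻¹ :* a) refl (1/ a) a ⟩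
  1/ a * a          ≡⟨ ℚP.*-inverseˡ a ⟩
  1ℚ                ∎
  where open ≡-Reasoning
        a = fromℕ (suc m)

*-cancelˡ-≢0 : ∀ {a x y} → a ≢ 0ℚ → a * x ≡ a * y → x ≡ y
*-cancelˡ-≢0 {a} {x} {y} a≢0 e = begin
  x              ≡⟨ solve 3 (λ a⁻¹ a x → x := a⁻¹ :* (a :* x) :+ (con 1ℚ :- a⁻¹ :* a) :* x) refl a⁻¹ a x ⟩
  a⁻¹ * (a * x) + (1ℚ - a⁻¹ * a) * x  ≡⟨ cong₂ (λ s t → a⁻¹ * s + (1ℚ - t) * x) e inv ⟩
  a⁻¹ * (a * y) + (1ℚ - 1ℚ) * x       ≡⟨ solve 4 (λ a⁻¹ a y x → a⁻¹ :* (a :* y) :+ (con 1ℚ :- con 1ℚ) :* x := (a⁻¹ :* a) :* y) refl a⁻¹ a y x ⟩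
  (a⁻¹ * a) * y  ≡⟨ cong (_* y) inv ⟩
  1ℚ * y         ≡⟨ ℚP.*-identityˡ y ⟩
  y              ∎
  where open ≡-Reasoning
        a⁻¹ = (1/ a) {{ℚ.≢-nonZero a≢0}}
        inv : a⁻¹ * a ≡ 1ℚ
        inv = ℚP.*-inverseˡ a {{ℚ.≢-nonZero a≢0}}

*-≢0 : ∀ {a b} → a ≢ 0ℚ → b ≢ 0ℚ → a * b ≢ 0ℚ
*-≢0 {a} a≢0 b≢0 ab≡0 = b≢0 (*-cancelˡ-≢0 a≢0 (trans ab≡0 (sym (ℚP.*-zeroʳ a))))

ℤ→ℚ-≢0 : ∀ z → z ≢ + 0 → ℤ→ℚ z ≢ 0ℚ
ℤ→ℚ-≢0 z z≢0 e = ℚP.1≢0 (begin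
  1ℚ                   ≡⟨ sym (recipℤ-inverseˡ z z≢0) ⟩
  recipℤ z * ℤ→ℚ z     ≡⟨ cong (recipℤ z *_) e ⟩
  recipℤ z * 0ℚ        ≡⟨ ℚP.*-zeroʳ (recipℤ z) ⟩
  0ℚ                   ∎)
  where open ≡-Reasoning

distinct-scalars⇒≡0 : ∀ {a b} x → a ≢ b → a * x ≡ b * x → x ≡ 0ℚ
distinct-scalars⇒≡0 {a} {b} x a≢b e = *-cancelˡ-≢0 a-b≢0 (begin
  (a - b) * x    ≡⟨ solve 3 (λ a b x → (a :- b) :* x := a :* x :- b :* x) refl a b x ⟩
  a * x - b * x  ≡⟨ cong (_- b * x) e ⟩
  b * x - b * x  ≡⟨ ℚP.+-inverseʳ (b * x) ⟩
  0ℚ             ≡⟨ sym (ℚP.*-zeroʳ (a - b)) ⟩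
  (a - b) * 0ℚ   ∎)
  where open ≡-Reasoning
        a-b≢0 : a - b ≢ 0ℚ
        a-b≢0 e′ = a≢b (begin
          a              ≡⟨ solve 2 (λ a b → a := (a :- b) :+ b) refl a b ⟩
          (a - b) + b    ≡⟨ cong (_+ b) e′ ⟩
          0ℚ + b         ≡⟨ ℚP.+-identityˡ b ⟩
          b              ∎)

ℕ≡ℤ*ℕ⇒≤ : ∀ z m l → z ≢ + 0 → ℕ→ℚ m ≡ ℤ→ℚ z * ℕ→ℚ l → l ≤ m
ℕ≡ℤ*ℕ⇒≤ (+ zero)  m l z≢0 _ = ⊥-elim (z≢0 refl)
ℕ≡ℤ*ℕ⇒≤ (+ suc t) m l _ e = subst (l ≤_) (sym m≡tl) (ℕP.m≤n*m l (suc t))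
  where m≡tl : m ≡ suc t ℕ.* l
        m≡tl = ℕ→ℚ-injective (trans e (sym (ℕ→ℚ-* (suc t) l)))
ℕ≡ℤ*ℕ⇒≤ -[1+ t ]  m l _ e =
  ℕP.≤-trans (ℕP.m≤n*m l (suc t)) (ℕP.≤-trans (ℕP.m≤n+m (suc t ℕ.* l) m) (subst (ℕ._≤ m) (sym m+tl≡0) z≤n))
  where
  open ≡-Reasoning
  m+tl≡0 : m ℕ.+ suc t ℕ.* l ≡ 0
  m+tl≡0 = ℕ→ℚ-injective (begin
    ℕ→ℚ (m ℕ.+ suc t ℕ.* l)            ≡⟨ trans (ℕ→ℚ-+ m _) (cong (_+_ (ℕ→ℚ m)) (ℕ→ℚ-* (suc t) l)) ⟩
    ℕ→ℚ m + ℕ→ℚ (suc t) * ℕ→ℚ l       ≡⟨ cong (_+ ℕ→ℚ (suc t) * ℕ→ℚ l) e ⟩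
    (- ℕ→ℚ (suc t)) * ℕ→ℚ l + ℕ→ℚ (suc t) * ℕ→ℚ l
      ≡⟨ solve 2 (λ a b → (:- a) :* b :+ a :* b := con 0ℚ) refl (ℕ→ℚ (suc t)) (ℕ→ℚ l) ⟩
    0ℚ                                  ∎)

one-of-three : ∀ (ν a b c : ℚ) → (ν ≢ a → ν ≢ b → ν ≢ c → ⊥) → (ν ≡ a) ⊎ ((ν ≡ b) ⊎ (ν ≡ c))
one-of-three ν a b c none with ν ℚ.≟ a | ν ℚ.≟ b | ν ℚ.≟ c
... | yes ν≡a | _       | _       = inj₁ ν≡a
... | no  _   | yes ν≡b | _       = inj₂ (inj₁ ν≡b)
... | no  _   | no  _   | yes ν≡c = inj₂ (inj₂ ν≡c)
... | no  ν≢a | no  ν≢b | no  ν≢c = ⊥-elim (none ν≢a ν≢b ν≢c)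

nonzero-at-one-of : ∀ {A : Set} (f : A → ℚ) x y → (f x ≡ 0ℚ → f y ≢ 0ℚ) → Σ A λ z → f z ≢ 0ℚ
nonzero-at-one-of f x y not-both with f x ℚ.≟ 0ℚ
... | yes fx≡0 = y , not-both fx≡0
... | no  fx≢0 = x , fx≢0

𝟙 : Bool → ℚ
𝟙 b = if b then 1ℚ else 0ℚ

𝟙-∧ : ∀ a b → 𝟙 (a ∧ b) ≡ 𝟙 a * 𝟙 b
𝟙-∧ true  b = sym (ℚP.*-identityˡ (𝟙 b))
𝟙-∧ false b = sym (ℚP.*-zeroˡ (𝟙 b))

private
  ∑ : ∀ {A : Set} → List A → (A → ℚ) → ℚ
  ∑ xs f = foldr (λ z acc → f z + acc) 0ℚ xs

  ∑-cong : ∀ {A : Set} (xs : List A) {f g : A → ℚ} → (∀ z → f z ≡ g z) → ∑ xs f ≡ ∑ xs g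
  ∑-cong []       e = refl
  ∑-cong (x ∷ xs) e = cong₂ _+_ (e x) (∑-cong xs e)

  ∑-+ : ∀ {A : Set} (xs : List A) (f g : A → ℚ) → ∑ xs (λ z → f z + g z) ≡ ∑ xs f + ∑ xs g
  ∑-+ []       f g = sym (ℚP.+-identityˡ 0ℚ)
  ∑-+ (x ∷ xs) f g rewrite ∑-+ xs f g =
    solve 4 (λ a b c d → (a :+ b) :+ (c :+ d) := (a :+ c) :+ (b :+ d)) refl (f x) (g x) (∑ xs f) (∑ xs g)

  ∑-*ˡ : ∀ {A : Set} (xs : List A) c (f : A → ℚ) → ∑ xs (λ z → c * f z) ≡ c * ∑ xs f
  ∑-*ˡ []       c f = sym (ℚP.*-zeroʳ c)
  ∑-*ˡ (x ∷ xs) c f rewrite ∑-*ˡ xs c f = sym (ℚP.*-distribˡ-+ c (f x) (∑ xs f))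

  ∑-swap : ∀ {A B : Set} (xs : List A) (ys : List B) (F : A → B → ℚ) →
           ∑ xs (λ x → ∑ ys (F x)) ≡ ∑ ys (λ y → ∑ xs (λ x → F x y))
  ∑-swap []       ys F = sym (trans (∑-cong ys (λ _ → sym (ℚP.*-zeroʳ 0ℚ))) (trans (∑-*ˡ ys 0ℚ (λ _ → 0ℚ)) (ℚP.*-zeroˡ (∑ ys (λ _ → 0ℚ)))))
  ∑-swap (x ∷ xs) ys F rewrite ∑-swap xs ys F = sym (∑-+ ys (F x) (λ y → ∑ xs (λ x → F x y)))

  ∑-map : ∀ {A B : Set} (h : A → B) (xs : List A) (f : B → ℚ) → ∑ (map h xs) f ≡ ∑ xs (λ z → f (h z))
  ∑-map h []       f = refl
  ∑-map h (x ∷ xs) f = cong (_+_ (f (h x))) (∑-map h xs f)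

  countList : ∀ {A : Set} → (A → Bool) → List A → ℕ
  countList f xs = foldr (λ z acc → if f z then suc acc else acc) zero xs

  countList-as-∑ : ∀ {A : Set} (f : A → Bool) (xs : List A) → ℕ→ℚ (countList f xs) ≡ ∑ xs (λ z → 𝟙 (f z))
  countList-as-∑ f []       = refl
  countList-as-∑ f (x ∷ xs) with f x
  ... | true  = trans (ℕ→ℚ-+ 1 (countList f xs)) (cong (_+_ 1ℚ) (countList-as-∑ f xs))
  ... | false = trans (countList-as-∑ f xs) (sym (ℚP.+-identityˡ _))

  countList-≢0 : ∀ {A : Set} (f : A → Bool) {xs : List A} {w : A} → w ∈ xs → f w ≡ true → countList f xs ≢ 0
  countList-≢0 f {x ∷ xs} (here refl) e rewrite e = λ ()
  countList-≢0 f {x ∷ xs} (there w∈xs) e with f x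
  ... | true  = λ ()
  ... | false = countList-≢0 f w∈xs e

module _ {n : ℕ} where

  Σv-cong : {f g : Fin n → ℚ} → (∀ z → f z ≡ g z) → Σv f ≡ Σv g
  Σv-cong = ∑-cong (allFin n)

  Σv-+ : (f g : Fin n → ℚ) → Σv (λ z → f z + g z) ≡ Σv f + Σv g
  Σv-+ = ∑-+ (allFin n)

  Σv-*ˡ : ∀ c (f : Fin n → ℚ) → Σv (λ z → c * f z) ≡ c * Σv f
  Σv-*ˡ = ∑-*ˡ (allFin n)

  Σv-swap : (F : Fin n → Fin n → ℚ) → Σv (λ x → Σv (F x)) ≡ Σv (λ y → Σv (λ x → F x y))
  Σv-swap = ∑-swap (allFin n) (allFin n)

  Σv-zero : Σv {n} (λ _ → 0ℚ) ≡ 0ℚ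
  Σv-zero = trans (Σv-cong (λ _ → sym (ℚP.*-zeroˡ 0ℚ))) (trans (Σv-*ˡ 0ℚ (λ _ → 0ℚ)) (ℚP.*-zeroˡ (Σv {n} (λ _ → 0ℚ))))

  Σv-- : (f g : Fin n → ℚ) → Σv (λ z → f z - g z) ≡ Σv f - Σv g
  Σv-- f g = begin
    Σv (λ z → f z - g z)            ≡⟨ Σv-cong (λ z → solve 2 (λ a b → a :- b := a :+ (:- con 1ℚ) :* b) refl (f z) (g z)) ⟩
    Σv (λ z → f z + (- 1ℚ) * g z)   ≡⟨ Σv-+ f _ ⟩
    Σv f + Σv (λ z → (- 1ℚ) * g z)  ≡⟨ cong (_+_ (Σv f)) (Σv-*ˡ (- 1ℚ) g) ⟩
    Σv f + (- 1ℚ) * Σv g            ≡⟨ solve 2 (λ a b → a :+ (:- con 1ℚ) :* b := a :- b) refl (Σv f) (Σv g) ⟩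
    Σv f - Σv g                     ∎
    where open ≡-Reasoning

  count-as-Σv : (f : Fin n → Bool) → ℕ→ℚ (count f) ≡ Σv (λ z → 𝟙 (f z))
  count-as-Σv f = countList-as-∑ f (allFin n)

  count-≢0 : (f : Fin n → Bool) {w : Fin n} → f w ≡ true → count f ≢ 0
  count-≢0 f {w} = countList-≢0 f (∈-allFin w)

Σv-suc : ∀ {n} (f : Fin (suc n) → ℚ) → Σv f ≡ f fzero + Σv (λ z → f (fsuc z))
Σv-suc {n} f = cong (_+_ (f fzero)) (trans (cong (λ l → ∑ l f) (sym (ListP.map-tabulate (λ z → z) fsuc))) (∑-map fsuc (allFin n) f))

Σv-const : ∀ {n} c → Σv {n} (λ _ → c) ≡ ℕ→ℚ n * c
Σv-const {zero}  c = sym (ℚP.*-zeroˡ c)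
Σv-const {suc n} c = begin
  Σv {suc n} (λ _ → c)     ≡⟨ Σv-suc {n} (λ _ → c) ⟩
  c + Σv {n} (λ _ → c)     ≡⟨ cong (_+_ c) (Σv-const {n} c) ⟩
  c + ℕ→ℚ n * c           ≡⟨ solve 2 (λ c m → c :+ m :* c := (con 1ℚ :+ m) :* c) refl c (ℕ→ℚ n) ⟩
  (1ℚ + ℕ→ℚ n) * c        ≡⟨ cong (_* c) (sym (ℕ→ℚ-+ 1 n)) ⟩
  ℕ→ℚ (suc n) * c         ∎
  where open ≡-Reasoning

≟-suc : ∀ {n} (x z : Fin n) → ⌊ fsuc x ≟ fsuc z ⌋ ≡ ⌊ x ≟ z ⌋
≟-suc x z with x ≟ z
... | yes _ = refl
... | no  _ = refl

Σv-point : ∀ {n} (x : Fin n) (f : Fin n → ℚ) → Σv (λ z → 𝟙 ⌊ x ≟ z ⌋ * f z) ≡ f x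
Σv-point {suc n} x f = trans (Σv-suc (λ z → 𝟙 ⌊ x ≟ z ⌋ * f z)) (go x)
  where
  open ≡-Reasoning
  go : ∀ x → 𝟙 ⌊ x ≟ fzero ⌋ * f fzero + Σv (λ z → 𝟙 ⌊ x ≟ fsuc z ⌋ * f (fsuc z)) ≡ f x
  go fzero = begin
    1ℚ * f fzero + Σv (λ z → 0ℚ * f (fsuc z))  ≡⟨ cong₂ _+_ (ℚP.*-identityˡ (f fzero)) (trans (Σv-cong (λ z → ℚP.*-zeroˡ (f (fsuc z)))) (Σv-zero {n})) ⟩
    f fzero + 0ℚ                               ≡⟨ ℚP.+-identityʳ (f fzero) ⟩
    f fzero                                    ∎
  go (fsuc x) = begin
    0ℚ * f fzero + Σv (λ z → 𝟙 ⌊ fsuc x ≟ fsuc z ⌋ * f (fsuc z))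
      ≡⟨ cong₂ _+_ (ℚP.*-zeroˡ (f fzero)) (Σv-cong (λ z → cong (λ b → 𝟙 b * f (fsuc z)) (≟-suc x z))) ⟩
    0ℚ + Σv (λ z → 𝟙 ⌊ x ≟ z ⌋ * f (fsuc z))            ≡⟨ ℚP.+-identityˡ (Σv (λ z → 𝟙 ⌊ x ≟ z ⌋ * f (fsuc z))) ⟩
    Σv (λ z → 𝟙 ⌊ x ≟ z ⌋ * f (fsuc z))                 ≡⟨ Σv-point x (λ z → f (fsuc z)) ⟩
    f (fsuc x)                                          ∎

Σv-linear₃ : ∀ {n} (a b c : ℚ) (f g h : Fin n → ℚ) →
             Σv (λ z → a * f z + b * g z + c * h z) ≡ a * Σv f + b * Σv g + c * Σv h
Σv-linear₃ a b c f g h = begin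
  Σv (λ z → a * f z + b * g z + c * h z)            ≡⟨ Σv-+ (λ z → a * f z + b * g z) (λ z → c * h z) ⟩
  Σv (λ z → a * f z + b * g z) + Σv (λ z → c * h z) ≡⟨ cong₂ _+_ (Σv-+ (λ z → a * f z) (λ z → b * g z)) (Σv-*ˡ c h) ⟩
  Σv (λ z → a * f z) + Σv (λ z → b * g z) + c * Σv h ≡⟨ cong₂ (λ s t → s + t + c * Σv h) (Σv-*ˡ a f) (Σv-*ˡ b g) ⟩
  a * Σv f + b * Σv g + c * Σv h                    ∎
  where open ≡-Reasoning

T-ext : ∀ {a b} → (T a → T b) → (T b → T a) → a ≡ b
T-ext {true}  {true}  _ _ = refl
T-ext {true}  {false} f _ = ⊥-elim (f _)
T-ext {false} {true}  _ g = ⊥-elim (g _)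
T-ext {false} {false} _ _ = refl

≡⇒≡ᵇ≡true : ∀ {m i} → m ≡ i → (m ≡ᵇ i) ≡ true
≡⇒≡ᵇ≡true {m} refl = Equivalence.to T-≡ (ℕP.≡⇒≡ᵇ m m refl)

≡ᵇ≡true⇒≡ : ∀ {m i} → (m ≡ᵇ i) ≡ true → m ≡ i
≡ᵇ≡true⇒≡ {m} {i} e = ℕP.≡ᵇ⇒≡ m i (Equivalence.from T-≡ e)


δ : ℕ → ℕ → ℚ
δ m i = 𝟙 (m ≡ᵇ i)

δ-refl : ∀ m → δ m m ≡ 1ℚ
δ-refl m rewrite ≡⇒≡ᵇ≡true {m} refl = refl

δ-≢ : ∀ {m i} → m ≢ i → δ m i ≡ 0ℚ
δ-≢ {m} {i} m≢i with m ≡ᵇ i in e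
... | false = refl
... | true  = ⊥-elim (m≢i (≡ᵇ≡true⇒≡ e))

δ-subst : ∀ m i (F : ℕ → ℚ) → δ m i * F m ≡ δ m i * F i
δ-subst m i F with m ℕP.≟ i
... | yes refl = refl
... | no  m≢i rewrite δ-≢ m≢i = trans (ℚP.*-zeroˡ (F m)) (sym (ℚP.*-zeroˡ (F i)))

δ-idem : ∀ m i → δ m i * δ m i ≡ δ m i
δ-idem m i with m ≡ᵇ i
... | true  = refl
... | false = refl

three-levels : ∀ m h (F : ℕ → ℚ) → h ≤ m → m ≤ suc (suc h) →
               F m ≡ δ m h * F h + δ m (suc h) * F (suc h) + δ m (suc (suc h)) * F (suc (suc h))
three-levels m h F h≤m m≤2+h with ℕP.<-cmp m (suc h)
... | tri< m<1+h _ _ with ℕP.≤-antisym (ℕP.m<1+n⇒m≤n m<1+h) h≤m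
...   | refl rewrite δ-refl m | δ-≢ (ℕP.<⇒≢ (ℕP.n<1+n m)) | δ-≢ (ℕP.<⇒≢ (ℕP.m<n⇒m<1+n (ℕP.n<1+n m))) =
  solve 3 (λ a b c → a := con 1ℚ :* a :+ con 0ℚ :* b :+ con 0ℚ :* c) refl (F m) (F (suc m)) (F (suc (suc m)))
three-levels m h F h≤m m≤2+h | tri≈ _ refl _
  rewrite δ-≢ (ℕP.>⇒≢ (ℕP.n<1+n h)) | δ-refl (suc h) | δ-≢ (ℕP.<⇒≢ (ℕP.n<1+n (suc h))) =
  solve 3 (λ a b c → b := con 0ℚ :* a :+ con 1ℚ :* b :+ con 0ℚ :* c) refl (F h) (F (suc h)) (F (suc (suc h)))
three-levels m h F h≤m m≤2+h | tri> _ _ m>1+h with ℕP.≤-antisym m≤2+h m>1+h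
...   | refl rewrite δ-≢ (ℕP.>⇒≢ (ℕP.m<n⇒m<1+n (ℕP.n<1+n h))) | δ-≢ (ℕP.>⇒≢ (ℕP.n<1+n (suc h))) | δ-refl (suc (suc h)) =
  solve 3 (λ a b c → c := con 0ℚ :* a :+ con 0ℚ :* b :+ con 1ℚ :* c) refl (F h) (F (suc h)) (F (suc (suc h)))

sumTo : ℕ → (ℕ → ℚ) → ℚ
sumTo zero    f = f 0
sumTo (suc D) f = sumTo D f + f (suc D)

sumTo-cong : ∀ D {f g : ℕ → ℚ} → (∀ i → i ≤ D → f i ≡ g i) → sumTo D f ≡ sumTo D g
sumTo-cong zero    e = e 0 z≤n
sumTo-cong (suc D) e = cong₂ _+_ (sumTo-cong D (λ i i≤D → e i (ℕP.m≤n⇒m≤1+n i≤D))) (e (suc D) ℕP.≤-refl)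

sumTo-*ˡ : ∀ D c (f : ℕ → ℚ) → sumTo D (λ i → c * f i) ≡ c * sumTo D f
sumTo-*ˡ zero    c f = refl
sumTo-*ˡ (suc D) c f rewrite sumTo-*ˡ D c f = sym (ℚP.*-distribˡ-+ c _ _)

sumTo-Σv : ∀ {n} D (F : ℕ → Fin n → ℚ) → sumTo D (λ i → Σv (F i)) ≡ Σv (λ z → sumTo D (λ i → F i z))
sumTo-Σv zero    F = refl
sumTo-Σv (suc D) F rewrite sumTo-Σv D F = sym (Σv-+ (λ z → sumTo D (λ i → F i z)) (F (suc D)))

sumTo-δ-beyond : ∀ D m a → D < m → sumTo D (λ i → δ m i * a) ≡ 0ℚ
sumTo-δ-beyond zero    m a D<m rewrite δ-≢ {m} {0} (ℕP.>⇒≢ D<m) = ℚP.*-zeroˡ a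
sumTo-δ-beyond (suc D) m a D<m
  rewrite sumTo-δ-beyond D m a (ℕP.<-trans (ℕP.n<1+n D) D<m) | δ-≢ {m} {suc D} (ℕP.>⇒≢ D<m) =
  trans (ℚP.+-identityˡ _) (ℚP.*-zeroˡ a)

sumTo-δ : ∀ D m a → m ≤ D → sumTo D (λ i → δ m i * a) ≡ a
sumTo-δ zero    zero a _ = ℚP.*-identityˡ a
sumTo-δ (suc D) m a m≤D with m ℕP.≟ suc D
... | yes refl rewrite sumTo-δ-beyond D (suc D) a (ℕP.n<1+n D) | δ-refl (suc D) =
  trans (ℚP.+-identityˡ _) (ℚP.*-identityˡ a)
... | no  m≢D rewrite sumTo-δ D m a (ℕP.≤-pred (ℕP.≤∧≢⇒< m≤D m≢D)) | δ-≢ m≢D =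
  trans (cong (_+_ a) (ℚP.*-zeroˡ a)) (ℚP.+-identityʳ a)

sumTo-≥-head : ∀ D (f : ℕ → ℚ) → (∀ i → 0ℚ ℚ.≤ f (suc i)) → f 0 ℚ.≤ sumTo D f
sumTo-≥-head zero    f _ = ℚP.≤-refl
sumTo-≥-head (suc D) f f≥0 = ℚP.≤-trans (sumTo-≥-head D f f≥0)
  (ℚP.≤-trans (ℚP.≤-reflexive (sym (ℚP.+-identityʳ (sumTo D f)))) (ℚP.+-monoʳ-≤ (sumTo D f) (f≥0 D)))

firstTrue-≤ : ∀ N f → firstTrue N f ≤ N
firstTrue-≤ zero    f = z≤n
firstTrue-≤ (suc N) f with f 0
... | true  = z≤n
... | false = s≤s (firstTrue-≤ N (λ m → f (suc m)))

firstTrue-minimal : ∀ N f m → T (f m) → m < N → firstTrue N f ≤ m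
firstTrue-minimal (suc N) f m fm m<N with f 0 in f0
... | true = z≤n
firstTrue-minimal (suc N) f zero    fm m<N       | false rewrite f0 = ⊥-elim fm
firstTrue-minimal (suc N) f (suc m) fm (s≤s m<N) | false = s≤s (firstTrue-minimal N (λ m → f (suc m)) m fm m<N)

firstTrue-sound : ∀ N f → firstTrue N f < N → T (f (firstTrue N f))
firstTrue-sound (suc N) f ft<N with f 0 in f0
... | true  rewrite f0 = _
... | false = firstTrue-sound N (λ m → f (suc m)) (ℕP.≤-pred ft<N)

firstTrue-cong : ∀ N {f g} → (∀ m → f m ≡ g m) → firstTrue N f ≡ firstTrue N g
firstTrue-cong zero    e = refl
firstTrue-cong (suc N) {f} {g} e rewrite e 0 with g 0
... | true  = refl
... | false = cong suc (firstTrue-cong N (λ m → e (suc m)))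

module _ {n : ℕ} where

  any-intro : (p : Fin n → Bool) (z : Fin n) → T (p z) → T (any p (allFin n))
  any-intro p z pz = any⁺ p (lose (∈-allFin z) pz)

  any-elim : (p : Fin n → Bool) → T (any p (allFin n)) → ∃ λ z → T (p z)
  any-elim p h = satisfied (any⁻ p (allFin n) h)

module Distance {n : ℕ} (G : Graph n) where
  open Graph G using (adj; irrefl)

  d : Fin n → Fin n → ℕ
  d = dist G

  adj-sym : ∀ {x y} → T (adj x y) → T (adj y x)
  adj-sym {x} {y} = subst T (Graph.sym G x y)

  walk-snoc : ∀ k {x y z} → T (walk G k x y) → T (adj y z) → T (walk G (suc k) x z)
  walk-snoc zero {x} {y} {z} w a with toWitness w
  ... | refl = any-intro (λ v → adj x v ∧ ⌊ v ≟ z ⌋) z (Equivalence.from T-∧ (a , fromWitness refl))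
  walk-snoc (suc k) {x} {y} {z} w a with any-elim (λ v → adj x v ∧ walk G k v y) w
  ... | v , h with Equivalence.to T-∧ h
  ... | xv , wv = any-intro (λ v → adj x v ∧ walk G (suc k) v z) v
                    (Equivalence.from T-∧ (xv , walk-snoc k wv a))

  walk-reverse : ∀ k {x y} → T (walk G k x y) → T (walk G k y x)
  walk-reverse zero {x} {y} w with toWitness w
  ... | refl = w
  walk-reverse (suc k) {x} {y} w with any-elim (λ v → adj x v ∧ walk G k v y) w
  ... | v , h with Equivalence.to T-∧ h
  ... | xv , wv = walk-snoc k (walk-reverse k wv) (adj-sym xv)

  dist-sym : ∀ x y → d x y ≡ d y x
  dist-sym x y = firstTrue-cong n (λ k → T-ext (walk-reverse k) (walk-reverse k))

  dist-≤ : ∀ x y → d x y ≤ n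
  dist-≤ x y = firstTrue-≤ n _

  private
    n>0 : Fin n → 0 < n
    n>0 fzero    = s≤s z≤n
    n>0 (fsuc _) = s≤s z≤n

  walk-dist : ∀ {x y} → d x y < n → T (walk G (d x y) x y)
  walk-dist {x} {y} = firstTrue-sound n (λ k → walk G k x y)

  dist-≤-walk : ∀ {x y} k → T (walk G k x y) → k < n → d x y ≤ k
  dist-≤-walk {x} {y} = firstTrue-minimal n (λ k → walk G k x y)

  dist-refl : ∀ x → d x x ≡ 0
  dist-refl x = ℕP.n≤0⇒n≡0 (dist-≤-walk 0 (fromWitness refl) (n>0 x))

  dist≡0⇒≡ : ∀ {x y} → d x y ≡ 0 → x ≡ y
  dist≡0⇒≡ {x} {y} e = toWitness (subst (λ m → T (walk G m x y)) e (walk-dist (subst (_< n) (sym e) (n>0 x))))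

  dist-adj : ∀ {x y z} → T (adj y z) → d x z ≤ suc (d x y)
  dist-adj {x} {y} {z} a with suc (d x y) ℕP.<? n
  ... | yes lt = dist-≤-walk (suc (d x y)) (walk-snoc (d x y) (walk-dist (ℕP.<-trans (ℕP.n<1+n _) lt)) a) lt
  ... | no  ≮n = ℕP.≤-trans (dist-≤ x z) (ℕP.≮⇒≥ ≮n)

  module _ (n>1 : 1 < n) where

    adj⇒dist≡1 : ∀ {x z} → T (adj x z) → d x z ≡ 1
    adj⇒dist≡1 {x} {z} a with d x z in e
    ... | zero = ⊥-elim (subst T (irrefl x) (subst (λ w → T (adj x w)) (sym (dist≡0⇒≡ e)) a))
    ... | suc zero = refl
    ... | suc (suc m) = ⊥-elim (ℕP.<⇒≱ (s≤s (s≤s z≤n)) (subst (_≤ 1) e (dist-≤-walk 1 (walk-snoc 0 (fromWitness refl) a) n>1)))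

    dist≡1⇒adj : ∀ {x z} → d x z ≡ 1 → T (adj x z)
    dist≡1⇒adj {x} {z} e with any-elim (λ v → adj x v ∧ ⌊ v ≟ z ⌋)
                                 (subst (λ m → T (walk G m x z)) e (walk-dist (subst (_< n) (sym e) n>1)))
    ... | v , h with Equivalence.to T-∧ h
    ... | xv , v≟z with toWitness {a? = v ≟ z} v≟z
    ... | refl = xv

    adj≡dist≡ᵇ1 : ∀ x z → adj x z ≡ (d x z ≡ᵇ 1)
    adj≡dist≡ᵇ1 x z = T-ext (λ a → ℕP.≡⇒≡ᵇ (d x z) 1 (adj⇒dist≡1 a)) (λ e → dist≡1⇒adj (ℕP.≡ᵇ⇒≡ (d x z) 1 e))

  level-crossing : ∀ k {y x′} x i → T (walk G k y x′) → suc i ≤ d x y → d x x′ ≤ i →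
                   Σ (Fin n) λ z → Σ (Fin n) λ w → T (adj z w) × (d x z ≡ i) × (d x w ≡ suc i)
  level-crossing zero {y} {x′} x i w i<dy dx′≤i with toWitness w
  ... | refl = ⊥-elim (ℕP.<⇒≱ i<dy dx′≤i)
  level-crossing (suc k) {y} {x′} x i w i<dy dx′≤i with any-elim (λ v → adj y v ∧ walk G k v x′) w
  ... | v , h with Equivalence.to T-∧ h
  ... | yv , wv with d x v ℕP.≤? i
  ... | no  dv≰i = level-crossing k x i wv (ℕP.≰⇒> dv≰i) dx′≤i
  ... | yes dv≤i = v , y , adj-sym yv , dv≡i , dy≡1+i
    where
    dy≤1+dv : d x y ≤ suc (d x v)
    dy≤1+dv = dist-adj (adj-sym yv)
    dy≡1+i : d x y ≡ suc i
    dy≡1+i = ℕP.≤-antisym (ℕP.≤-trans dy≤1+dv (s≤s dv≤i)) i<dy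
    dv≡i : d x v ≡ i
    dv≡i = ℕP.≤-antisym dv≤i (ℕP.≤-pred (ℕP.≤-trans i<dy dy≤1+dv))

-- Matrices M with M² = κ M

infixr 9 _·_

_·_ : ∀ {n} → (Fin n → Fin n → ℚ) → (Fin n → ℚ) → Fin n → ℚ
(M · v) x = Σv (λ y → M x y * v y)

module _ {n : ℕ} (M : Fin n → Fin n → ℚ) where

  ·-*ˡ : ∀ c v x → (M · (λ y → c * v y)) x ≡ c * (M · v) x
  ·-*ˡ c v x = trans (Σv-cong (λ y → solve 3 (λ m c v → m :* (c :* v) := c :* (m :* v)) refl (M x y) c (v y)))
                     (Σv-*ˡ c (λ y → M x y * v y))

  ·-+ : ∀ v w x → (M · (λ y → v y + w y)) x ≡ (M · v) x + (M · w) x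
  ·-+ v w x = trans (Σv-cong (λ y → ℚP.*-distribˡ-+ (M x y) (v y) (w y))) (Σv-+ (λ y → M x y * v y) (λ y → M x y * w y))

  ·-- : ∀ v w x → (M · (λ y → v y - w y)) x ≡ (M · v) x - (M · w) x
  ·-- v w x = trans (Σv-cong (λ y → solve 3 (λ m v w → m :* (v :- w) := m :* v :- m :* w) refl (M x y) (v y) (w y))) (Σv-- (λ y → M x y * v y) (λ y → M x y * w y))

module ScaledIdempotent {n : ℕ} (M : Fin n → Fin n → ℚ) (κ : ℚ)
  (M-sym : ∀ x y → M x y ≡ M y x)
  (M-rowSum : ∀ x → Σv (M x) ≡ 0ℚ)
  (M²≡κM : ∀ x z → Σv (λ y → M x y * M y z) ≡ κ * M x z)
  where

  ·-const : ∀ c x → (M · (λ _ → c)) x ≡ 0ℚ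
  ·-const c x = begin
    Σv (λ y → M x y * c)   ≡⟨ Σv-cong (λ y → ℚP.*-comm (M x y) c) ⟩
    Σv (λ y → c * M x y)   ≡⟨ Σv-*ˡ c (M x) ⟩
    c * Σv (M x)           ≡⟨ cong (c *_) (M-rowSum x) ⟩
    c * 0ℚ                 ≡⟨ ℚP.*-zeroʳ c ⟩
    0ℚ                     ∎
    where open ≡-Reasoning

  Σv-· : ∀ v → Σv (M · v) ≡ 0ℚ
  Σv-· v = begin
    Σv (λ x → Σv (λ y → M x y * v y))  ≡⟨ Σv-swap (λ x y → M x y * v y) ⟩
    Σv (λ y → Σv (λ x → M x y * v y))  ≡⟨ Σv-cong (λ y → trans (Σv-cong (λ x → cong (_* v y) (M-sym x y))) (·-const (v y) y)) ⟩
    Σv {n} (λ _ → 0ℚ)                  ≡⟨ Σv-zero {n} ⟩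
    0ℚ                                 ∎
    where open ≡-Reasoning

  ·-· : ∀ v x → (M · M · v) x ≡ κ * (M · v) x
  ·-· v x = begin
    Σv (λ y → M x y * Σv (λ z → M y z * v z))    ≡⟨ Σv-cong (λ y → sym (Σv-*ˡ (M x y) (λ z → M y z * v z))) ⟩
    Σv (λ y → Σv (λ z → M x y * (M y z * v z)))  ≡⟨ Σv-swap (λ y z → M x y * (M y z * v z)) ⟩
    Σv (λ z → Σv (λ y → M x y * (M y z * v z)))  ≡⟨ Σv-cong (λ z → trans (Σv-cong (λ y → sym (ℚP.*-assoc (M x y) (M y z) (v z))))
                                                                   (trans (Σv-cong (λ y → ℚP.*-comm (M x y * M y z) (v z)))
                                                                          (Σv-*ˡ (v z) (λ y → M x y * M y z)))) ⟩
    Σv (λ z → v z * Σv (λ y → M x y * M y z))    ≡⟨ Σv-cong (λ z → cong (v z *_) (M²≡κM x z)) ⟩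
    Σv (λ z → v z * (κ * M x z))                 ≡⟨ Σv-cong (λ z → solve 3 (λ v k m → v :* (k :* m) := k :* (m :* v)) refl (v z) κ (M x z)) ⟩
    Σv (λ z → κ * (M x z * v z))                 ≡⟨ Σv-*ˡ κ (λ z → M x z * v z) ⟩
    κ * (M · v) x                                ∎
    where open ≡-Reasoning

  Σv-column : ∀ x₀ → Σv (λ y → M y x₀) ≡ 0ℚ
  Σv-column x₀ = trans (Σv-cong (λ y → M-sym y x₀)) (M-rowSum x₀)

  module Shifted (s : ℚ) (s≢0 : s ≢ 0ℚ) (N : Fin n → Fin n → ℚ) (N≡ : ∀ x y → N x y ≡ s * (M x y - 1ℚ)) where

    ·-N : ∀ v x → (N · v) x ≡ s * ((M · v) x - Σv v)
    ·-N v x = begin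
      Σv (λ y → N x y * v y)                 ≡⟨ Σv-cong (λ y → trans (cong (_* v y) (N≡ x y))
                                                  (solve 3 (λ s m v → s :* (m :- con 1ℚ) :* v := s :* (m :* v :- v)) refl s (M x y) (v y))) ⟩
      Σv (λ y → s * (M x y * v y - v y))     ≡⟨ Σv-*ˡ s (λ y → M x y * v y - v y) ⟩
      s * Σv (λ y → M x y * v y - v y)       ≡⟨ cong (s *_) (Σv-- (λ y → M x y * v y) v) ⟩
      s * ((M · v) x - Σv v)                 ∎
      where open ≡-Reasoning

    λ₁ λ₂ : ℚ
    λ₁ = s * κ
    λ₂ = - (s * ℕ→ℚ n)

    -- an eigenvector of N for ν ≠ λ₁ is killed by M, and one for ν ≠ λ₂ sums to 0
    eigen-· : ∀ ν v → (∀ x → (N · v) x ≡ ν * v x) → ∀ x → ν * (M · v) x ≡ λ₁ * (M · v) x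
    eigen-· ν v Nv≡νv x = begin
      ν * (M · v) x                               ≡⟨ sym (·-*ˡ M ν v x) ⟩
      (M · (λ z → ν * v z)) x                     ≡⟨ Σv-cong (λ z → cong (M x z *_) (trans (sym (Nv≡νv z)) (·-N v z))) ⟩
      (M · (λ z → s * ((M · v) z - Σv v))) x      ≡⟨ ·-*ˡ M s (λ z → (M · v) z - Σv v) x ⟩
      s * (M · (λ z → (M · v) z - Σv v)) x        ≡⟨ cong (s *_) (·-- M (M · v) (λ _ → Σv v) x) ⟩
      s * ((M · M · v) x - (M · (λ _ → Σv v)) x)  ≡⟨ cong₂ (λ a b → s * (a - b)) (·-· v x) (·-const (Σv v) x) ⟩
      s * (κ * (M · v) x - 0ℚ)                    ≡⟨ solve 3 (λ s k m → s :* (k :* m :- con 0ℚ) := (s :* k) :* m) refl s κ ((M · v) x) ⟩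
      λ₁ * (M · v) x                              ∎
      where open ≡-Reasoning

    eigen-Σv : ∀ ν v → (∀ x → (N · v) x ≡ ν * v x) → ν * Σv v ≡ λ₂ * Σv v
    eigen-Σv ν v Nv≡νv = begin
      ν * Σv v                               ≡⟨ sym (Σv-*ˡ ν v) ⟩
      Σv (λ z → ν * v z)                     ≡⟨ Σv-cong (λ z → trans (sym (Nv≡νv z)) (·-N v z)) ⟩
      Σv (λ z → s * ((M · v) z - Σv v))      ≡⟨ Σv-*ˡ s (λ z → (M · v) z - Σv v) ⟩
      s * Σv (λ z → (M · v) z - Σv v)        ≡⟨ cong (s *_) (trans (Σv-- (M · v) (λ _ → Σv v)) (cong₂ _-_ (Σv-· v) (Σv-const {n} (Σv v)))) ⟩
      s * (0ℚ - ℕ→ℚ n * Σv v)                ≡⟨ solve 3 (λ s m w → s :* (con 0ℚ :- m :* w) := (:- (s :* m)) :* w) refl s (ℕ→ℚ n) (Σv v) ⟩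
      λ₂ * Σv v                              ∎
      where open ≡-Reasoning

    eigenvector-vanishes : ∀ ν v → ν ≢ 0ℚ → ν ≢ λ₁ → ν ≢ λ₂ → (∀ x → (N · v) x ≡ ν * v x) → ∀ x → v x ≡ 0ℚ
    eigenvector-vanishes ν v ν≢0 ν≢λ₁ ν≢λ₂ Nv≡νv x = *-cancelˡ-≢0 ν≢0 (begin
      ν * v x                 ≡⟨ sym (Nv≡νv x) ⟩
      (N · v) x               ≡⟨ ·-N v x ⟩
      s * ((M · v) x - Σv v)  ≡⟨ cong₂ (λ a b → s * (a - b)) Mv≡0 Σv≡0 ⟩
      s * (0ℚ - 0ℚ)           ≡⟨ solve 2 (λ s ν → s :* (con 0ℚ :- con 0ℚ) := ν :* con 0ℚ) refl s ν ⟩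
      ν * 0ℚ                  ∎)
      where
      open ≡-Reasoning
      Mv≡0 : (M · v) x ≡ 0ℚ
      Mv≡0 = distinct-scalars⇒≡0 ((M · v) x) ν≢λ₁ (eigen-· ν v Nv≡νv x)
      Σv≡0 : Σv v ≡ 0ℚ
      Σv≡0 = distinct-scalars⇒≡0 (Σv v) ν≢λ₂ (eigen-Σv ν v Nv≡νv)

    eigenvalue-cases : ∀ ν → IsEigenvalue N ν → (ν ≡ 0ℚ) ⊎ ((ν ≡ λ₁) ⊎ (ν ≡ λ₂))
    eigenvalue-cases ν (v , (x , vx≢0) , Nv≡νv) =
      one-of-three ν 0ℚ λ₁ λ₂ (λ ν≢0 ν≢λ₁ ν≢λ₂ → vx≢0 (eigenvector-vanishes ν v ν≢0 ν≢λ₁ ν≢λ₂ Nv≡νv x))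

    λ₁-is-eigenvalue : ∀ x₀ → M x₀ x₀ ≢ 0ℚ → IsEigenvalue N λ₁
    λ₁-is-eigenvalue x₀ Mx₀x₀≢0 = (λ y → M y x₀) , (x₀ , Mx₀x₀≢0) , λ x → begin
      (N · (λ y → M y x₀)) x                            ≡⟨ ·-N (λ y → M y x₀) x ⟩
      s * ((M · (λ y → M y x₀)) x - Σv (λ y → M y x₀))  ≡⟨ cong₂ (λ a b → s * (a - b)) (M²≡κM x x₀) (Σv-column x₀) ⟩
      s * (κ * M x x₀ - 0ℚ)                             ≡⟨ solve 3 (λ s k m → s :* (k :* m :- con 0ℚ) := (s :* k) :* m) refl s κ (M x x₀) ⟩
      λ₁ * M x x₀                                       ∎
      where open ≡-Reasoning

    λ₂-is-eigenvalue : Fin n → IsEigenvalue N λ₂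
    λ₂-is-eigenvalue x₀ = (λ _ → 1ℚ) , (x₀ , ℚP.1≢0) , λ x → begin
      (N · (λ _ → 1ℚ)) x                                ≡⟨ ·-N (λ _ → 1ℚ) x ⟩
      s * ((M · (λ _ → 1ℚ)) x - Σv {n} (λ _ → 1ℚ))      ≡⟨ cong₂ (λ a b → s * (a - b)) (·-const 1ℚ x) (Σv-const {n} 1ℚ) ⟩
      s * (0ℚ - ℕ→ℚ n * 1ℚ)                             ≡⟨ solve 2 (λ s m → s :* (con 0ℚ :- m :* con 1ℚ) := (:- (s :* m)) :* con 1ℚ) refl s (ℕ→ℚ n) ⟩
      λ₂ * 1ℚ                                           ∎
      where open ≡-Reasoning

    module _ (κ≢0 : κ ≢ 0ℚ) (n≢0 : n ≢ 0) where

      private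
        κ⁻¹ n⁻¹ : ℚ
        κ⁻¹ = (1/ κ) {{ℚ.≢-nonZero κ≢0}}
        n⁻¹ = (1/ ℕ→ℚ n) {{ℚ.≢-nonZero (ℕ→ℚ-≢0 n≢0)}}

        κ⁻¹κ : κ⁻¹ * κ ≡ 1ℚ
        κ⁻¹κ = ℚP.*-inverseˡ κ {{ℚ.≢-nonZero κ≢0}}

        nn⁻¹ : ℕ→ℚ n * n⁻¹ ≡ 1ℚ
        nn⁻¹ = ℚP.*-inverseʳ (ℕ→ℚ n) {{ℚ.≢-nonZero (ℕ→ℚ-≢0 n≢0)}}

      module Decomposition (w : Fin n → ℚ) where

        w₀ w₁ w₂ : Fin n → ℚ
        w₂ _ = n⁻¹ * Σv w
        w₁ x = κ⁻¹ * (M · w) x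
        w₀ x = w x - (w₁ x + w₂ x)

        split : ∀ x → w x ≡ w₀ x + (w₁ x + w₂ x)
        split x = solve 2 (λ a b → a := (a :- b) :+ b) refl (w x) (w₁ x + w₂ x)

        ·-w₁ : ∀ x → (M · w₁) x ≡ (M · w) x
        ·-w₁ x = begin
          (M · w₁) x                 ≡⟨ ·-*ˡ M κ⁻¹ (M · w) x ⟩
          κ⁻¹ * (M · M · w) x        ≡⟨ cong (κ⁻¹ *_) (·-· w x) ⟩
          κ⁻¹ * (κ * (M · w) x)      ≡⟨ sym (ℚP.*-assoc κ⁻¹ κ ((M · w) x)) ⟩
          (κ⁻¹ * κ) * (M · w) x      ≡⟨ cong (_* (M · w) x) κ⁻¹κ ⟩
          1ℚ * (M · w) x             ≡⟨ ℚP.*-identityˡ ((M · w) x) ⟩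
          (M · w) x                  ∎
          where open ≡-Reasoning

        Σv-w₁ : Σv w₁ ≡ 0ℚ
        Σv-w₁ = trans (Σv-*ˡ κ⁻¹ (M · w)) (trans (cong (κ⁻¹ *_) (Σv-· w)) (ℚP.*-zeroʳ κ⁻¹))

        Σv-w₂ : Σv w₂ ≡ Σv w
        Σv-w₂ = begin
          Σv w₂                        ≡⟨ Σv-const {n} (n⁻¹ * Σv w) ⟩
          ℕ→ℚ n * (n⁻¹ * Σv w)         ≡⟨ sym (ℚP.*-assoc (ℕ→ℚ n) n⁻¹ (Σv w)) ⟩
          (ℕ→ℚ n * n⁻¹) * Σv w         ≡⟨ cong (_* Σv w) nn⁻¹ ⟩
          1ℚ * Σv w                    ≡⟨ ℚP.*-identityˡ (Σv w) ⟩
          Σv w                         ∎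
          where open ≡-Reasoning

        ·-w₀ : ∀ x → (M · w₀) x ≡ 0ℚ
        ·-w₀ x = begin
          (M · w₀) x                                ≡⟨ ·-- M w (λ y → w₁ y + w₂ y) x ⟩
          (M · w) x - (M · (λ y → w₁ y + w₂ y)) x   ≡⟨ cong (_-_ ((M · w) x)) (·-+ M w₁ w₂ x) ⟩
          (M · w) x - ((M · w₁) x + (M · w₂) x)     ≡⟨ cong₂ (λ a b → (M · w) x - (a + b)) (·-w₁ x) (·-const (n⁻¹ * Σv w) x) ⟩
          (M · w) x - ((M · w) x + 0ℚ)              ≡⟨ solve 1 (λ a → a :- (a :+ con 0ℚ) := con 0ℚ) refl ((M · w) x) ⟩
          0ℚ                                        ∎
          where open ≡-Reasoning

        Σv-w₀ : Σv w₀ ≡ 0ℚ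
        Σv-w₀ = begin
          Σv w₀                                   ≡⟨ Σv-- w (λ y → w₁ y + w₂ y) ⟩
          Σv w - Σv (λ y → w₁ y + w₂ y)           ≡⟨ cong (_-_ (Σv w)) (Σv-+ w₁ w₂) ⟩
          Σv w - (Σv w₁ + Σv w₂)                  ≡⟨ cong₂ (λ a b → Σv w - (a + b)) Σv-w₁ Σv-w₂ ⟩
          Σv w - (0ℚ + Σv w)                      ≡⟨ solve 1 (λ a → a :- (con 0ℚ :+ a) := con 0ℚ) refl (Σv w) ⟩
          0ℚ                                      ∎
          where open ≡-Reasoning

        eigen-w₀ : ∀ x → (N · w₀) x ≡ 0ℚ * w₀ x
        eigen-w₀ x = begin
          (N · w₀) x                ≡⟨ ·-N w₀ x ⟩
          s * ((M · w₀) x - Σv w₀)  ≡⟨ cong₂ (λ a b → s * (a - b)) (·-w₀ x) Σv-w₀ ⟩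
          s * (0ℚ - 0ℚ)             ≡⟨ solve 2 (λ s w → s :* (con 0ℚ :- con 0ℚ) := con 0ℚ :* w) refl s (w₀ x) ⟩
          0ℚ * w₀ x                 ∎
          where open ≡-Reasoning

        eigen-w₁ : ∀ x → (N · w₁) x ≡ λ₁ * w₁ x
        eigen-w₁ x = begin
          (N · w₁) x                        ≡⟨ ·-N w₁ x ⟩
          s * ((M · w₁) x - Σv w₁)          ≡⟨ cong₂ (λ a b → s * (a - b)) (·-w₁ x) Σv-w₁ ⟩
          s * ((M · w) x - 0ℚ)              ≡⟨ solve 4 (λ s k k⁻¹ m → s :* (m :- con 0ℚ) := (s :* k) :* (k⁻¹ :* m) :+ s :* (con 1ℚ :- k⁻¹ :* k) :* m)
                                                  refl s κ κ⁻¹ ((M · w) x) ⟩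
          λ₁ * w₁ x + s * (1ℚ - κ⁻¹ * κ) * (M · w) x
                                            ≡⟨ cong (λ t → λ₁ * w₁ x + s * (1ℚ - t) * (M · w) x) κ⁻¹κ ⟩
          λ₁ * w₁ x + s * (1ℚ - 1ℚ) * (M · w) x
                                            ≡⟨ solve 3 (λ a s m → a :+ s :* (con 1ℚ :- con 1ℚ) :* m := a) refl (λ₁ * w₁ x) s ((M · w) x) ⟩
          λ₁ * w₁ x                         ∎
          where open ≡-Reasoning

        eigen-w₂ : ∀ x → (N · w₂) x ≡ λ₂ * w₂ x
        eigen-w₂ x = begin
          (N · w₂) x                        ≡⟨ ·-N w₂ x ⟩
          s * ((M · w₂) x - Σv w₂)          ≡⟨ cong₂ (λ a b → s * (a - b)) (·-const (n⁻¹ * Σv w) x) Σv-w₂ ⟩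
          s * (0ℚ - Σv w)                   ≡⟨ solve 4 (λ s m m⁻¹ W → s :* (con 0ℚ :- W) := (:- (s :* m)) :* (m⁻¹ :* W) :+ s :* (m :* m⁻¹ :- con 1ℚ) :* W)
                                                  refl s (ℕ→ℚ n) n⁻¹ (Σv w) ⟩
          λ₂ * w₂ x + s * (ℕ→ℚ n * n⁻¹ - 1ℚ) * Σv w
                                            ≡⟨ cong (λ t → λ₂ * w₂ x + s * (t - 1ℚ) * Σv w) nn⁻¹ ⟩
          λ₂ * w₂ x + s * (1ℚ - 1ℚ) * Σv w  ≡⟨ solve 3 (λ a s m → a :+ s :* (con 1ℚ :- con 1ℚ) :* m := a) refl (λ₂ * w₂ x) s (Σv w) ⟩
          λ₂ * w₂ x                         ∎
          where open ≡-Reasoning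

      private
        κ⁻¹≢0 : κ⁻¹ ≢ 0ℚ
        κ⁻¹≢0 κ⁻¹≡0 = ℚP.1≢0 (trans (sym κ⁻¹κ) (trans (cong (_* κ) κ⁻¹≡0) (ℚP.*-zeroˡ κ)))

      -- off x₀ the 0-component of the unit vector at x₀ is z ↦ −(κ⁻¹ M z x₀ + c), which separates z₁ from z₂
      zero-is-eigenvalue : ∀ x₀ z₁ z₂ → z₁ ≢ x₀ → z₂ ≢ x₀ → M z₁ x₀ ≢ M z₂ x₀ → IsEigenvalue N 0ℚ
      zero-is-eigenvalue x₀ z₁ z₂ z₁≢x₀ z₂≢x₀ M₁≢M₂ = w₀ , nonzero , eigen-w₀
        where
        open ≡-Reasoning
        e : Fin n → ℚ
        e y = 𝟙 ⌊ x₀ ≟ y ⌋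
        open Decomposition e
        c : ℚ
        c = n⁻¹ * Σv e

        e-off : ∀ z → z ≢ x₀ → e z ≡ 0ℚ
        e-off z z≢x₀ with x₀ ≟ z
        ... | yes x₀≡z = ⊥-elim (z≢x₀ (sym x₀≡z))
        ... | no  _    = refl

        w₀-off : ∀ z → z ≢ x₀ → w₀ z ≡ - (κ⁻¹ * M z x₀ + c)
        w₀-off z z≢x₀ = begin
          e z - (κ⁻¹ * (M · e) z + c)       ≡⟨ cong₂ (λ a b → a - (κ⁻¹ * b + c)) (e-off z z≢x₀)
                                                 (trans (Σv-cong (λ y → ℚP.*-comm (M z y) (e y))) (Σv-point x₀ (M z))) ⟩
          0ℚ - (κ⁻¹ * M z x₀ + c)           ≡⟨ ℚP.+-identityˡ (- (κ⁻¹ * M z x₀ + c)) ⟩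
          - (κ⁻¹ * M z x₀ + c)              ∎

        nonzero : Σ (Fin n) λ x → w₀ x ≢ 0ℚ
        nonzero = nonzero-at-one-of w₀ z₁ z₂ λ w₀z₁≡0 w₀z₂≡0 → M₁≢M₂ (*-cancelˡ-≢0 κ⁻¹≢0 (begin
          κ⁻¹ * M z₁ x₀                      ≡⟨ solve 2 (λ a c → a := (a :+ c) :- c) refl (κ⁻¹ * M z₁ x₀) c ⟩
          (κ⁻¹ * M z₁ x₀ + c) - c            ≡⟨ cong (_- c) (ℚP.neg-injective (trans (sym (w₀-off z₁ z₁≢x₀))
                                                  (trans w₀z₁≡0 (trans (sym w₀z₂≡0) (w₀-off z₂ z₂≢x₀))))) ⟩
          (κ⁻¹ * M z₂ x₀ + c) - c            ≡⟨ solve 2 (λ a c → (a :+ c) :- c := a) refl (κ⁻¹ * M z₂ x₀) c ⟩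
          κ⁻¹ * M z₂ x₀                      ∎))

    exactlyThreeEigenvaluesOneZero : 0ℚ ℚ.< κ → ∀ x₀ z₁ z₂ → M x₀ x₀ ≢ 0ℚ → z₁ ≢ x₀ → z₂ ≢ x₀ → M z₁ x₀ ≢ M z₂ x₀ →
                                     ExactlyThreeEigenvaluesOneZero N
    exactlyThreeEigenvaluesOneZero 0<κ x₀ z₁ z₂ Mx₀x₀≢0 z₁≢x₀ z₂≢x₀ M₁≢M₂ =
      λ₁ , λ₂ , *-≢0 s≢0 κ≢0 , λ₂≢0 , λ₁≢λ₂ ,
      zero-is-eigenvalue κ≢0 n≢0 x₀ z₁ z₂ z₁≢x₀ z₂≢x₀ M₁≢M₂ , λ₁-is-eigenvalue x₀ Mx₀x₀≢0 , λ₂-is-eigenvalue x₀ ,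
      eigenvalue-cases ,
      λ w → let open Decomposition κ≢0 n≢0 w in w₀ , w₁ , w₂ , split , eigen-w₀ , eigen-w₁ , eigen-w₂
      where
      open ≡-Reasoning
      κ≢0 : κ ≢ 0ℚ
      κ≢0 = ℚP.<⇒≢ 0<κ ∘ sym
      n≢0 : n ≢ 0
      n≢0 n≡0 = ¬Fin0 (subst Fin n≡0 x₀)
      λ₂≢0 : λ₂ ≢ 0ℚ
      λ₂≢0 λ₂≡0 = *-≢0 s≢0 (ℕ→ℚ-≢0 n≢0) (ℚP.neg-injective λ₂≡0)
      κ+n≢0 : κ + ℕ→ℚ n ≢ 0ℚ
      κ+n≢0 = ℚP.<⇒≢ (ℚP.+-mono-<-≤ 0<κ (ℕ→ℚ-nonNeg n)) ∘ sym
      λ₁≢λ₂ : λ₁ ≢ λ₂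
      λ₁≢λ₂ λ₁≡λ₂ = *-≢0 s≢0 κ+n≢0 (begin
        s * (κ + ℕ→ℚ n)         ≡⟨ ℚP.*-distribˡ-+ s κ (ℕ→ℚ n) ⟩
        λ₁ + s * ℕ→ℚ n          ≡⟨ cong (_+ s * ℕ→ℚ n) λ₁≡λ₂ ⟩
        λ₂ + s * ℕ→ℚ n          ≡⟨ ℚP.+-inverseˡ (s * ℕ→ℚ n) ⟩
        0ℚ                      ∎)

-- Distance-regular graphs

module DistanceRegular {n : ℕ} (Γ : DRG n) (D : ℕ) (diam : HasDiameter (DRG.graph Γ) D) (1<D : 1 < D) where
  open DRG Γ
  open Distance graph public

  A : Fin n → Fin n → ℚ
  A = adjMatrix graph

  cℚ aℚ bℚ : ℕ → ℚ
  cℚ i = ℕ→ℚ (c i)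
  aℚ i = ℕ→ℚ (a i)
  bℚ i = ℕ→ℚ (b i)

  kℚ : ℚ
  kℚ = ℕ→ℚ k

  dist-≤-D : ∀ x y → d x y ≤ D
  dist-≤-D = proj₁ diam

  x₀ y₀ : Fin n
  x₀ = proj₁ (proj₂ diam)
  y₀ = proj₁ (proj₂ (proj₂ diam))

  dist-x₀y₀ : d x₀ y₀ ≡ D
  dist-x₀y₀ = proj₂ (proj₂ (proj₂ diam))

  n>1 : 1 < n
  n>1 = ℕP.≤-trans 1<D (subst (_≤ n) dist-x₀y₀ (dist-≤ x₀ y₀))

  A≡δ1 : ∀ x z → A x z ≡ δ (d x z) 1
  A≡δ1 x z = cong 𝟙 (adj≡dist≡ᵇ1 n>1 x z)

  Σv-δδ : ∀ x y i j → Σv (λ z → δ (d x z) i * δ (d y z) j) ≡ ℕ→ℚ (p (d x y) i j)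
  Σv-δδ x y i j = begin
    Σv (λ z → δ (d x z) i * δ (d y z) j)               ≡⟨ Σv-cong (λ z → sym (𝟙-∧ (d x z ≡ᵇ i) (d y z ≡ᵇ j))) ⟩
    Σv (λ z → 𝟙 ((d x z ≡ᵇ i) ∧ (d y z ≡ᵇ j)))        ≡⟨ sym (count-as-Σv (λ z → (d x z ≡ᵇ i) ∧ (d y z ≡ᵇ j))) ⟩
    ℕ→ℚ (count (λ z → (d x z ≡ᵇ i) ∧ (d y z ≡ᵇ j)))   ≡⟨ cong ℕ→ℚ (isDR x y i j) ⟩
    ℕ→ℚ (p (d x y) i j)                                ∎
    where open ≡-Reasoning

  Σv-Aδ : ∀ x y j → Σv (λ z → A x z * δ (d y z) j) ≡ ℕ→ℚ (p (d x y) 1 j)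
  Σv-Aδ x y j = trans (Σv-cong (λ z → cong (_* δ (d y z) j) (A≡δ1 x z))) (Σv-δδ x y 1 j)

  edge-at-level : ∀ i → i < D → Σ (Fin n) λ z → Σ (Fin n) λ w → T (Graph.adj graph z w) × (d x₀ z ≡ i) × (d x₀ w ≡ suc i)
  edge-at-level i i<D = level-crossing (proj₁ (connected y₀ x₀)) x₀ i (Equivalence.from T-≡ (proj₂ (connected y₀ x₀)))
                          (subst (suc i ≤_) (sym dist-x₀y₀) i<D) (subst (_≤ i) (sym (dist-refl x₀)) z≤n)

  private
    count-witness : ∀ x y i j {w} → d x w ≡ i → d y w ≡ j → p (d x y) i j ≢ 0
    count-witness x y i j {w} dxw dyw = subst (_≢ 0) (isDR x y i j)
      (count-≢0 (λ z → (d x z ≡ᵇ i) ∧ (d y z ≡ᵇ j)) (cong₂ _∧_ (≡⇒≡ᵇ≡true dxw) (≡⇒≡ᵇ≡true dyw)))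

  vertex-at : ∀ h → h < D → Σ (Fin n) λ w → d x₀ w ≡ suc h
  vertex-at h h<D = let _ , w , _ , _ , dw = edge-at-level h h<D in w , dw

  b≢0 : ∀ i → i < D → b i ≢ 0
  b≢0 i i<D =
    let z , w , zw , dz , dw = edge-at-level i i<D in subst (λ h → p h 1 (suc i) ≢ 0) (trans (dist-sym z x₀) dz)
                                 (count-witness z x₀ 1 (suc i) (adj⇒dist≡1 n>1 zw) dw)

  c≢0 : ∀ i → i < D → c (suc i) ≢ 0
  c≢0 i i<D =
    let z , w , zw , dz , dw = edge-at-level i i<D in subst (λ h → p h 1 i ≢ 0) (trans (dist-sym w x₀) dw)
                                 (count-witness w x₀ 1 i (adj⇒dist≡1 n>1 (adj-sym zw)) dz)

  neighbour-sum : ∀ x y (f : ℕ → ℚ) h → d x y ≡ suc h →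
    Σv (λ z → A x z * f (d y z)) ≡ f h * cℚ (suc h) + f (suc h) * aℚ (suc h) + f (suc (suc h)) * bℚ (suc h)
  neighbour-sum x y f h dxy = begin
    Σv (λ z → A x z * f (d y z))
      ≡⟨ Σv-cong pointwise ⟩
    Σv (λ z → f h * (A x z * δ (d y z) h) + f (suc h) * (A x z * δ (d y z) (suc h)) + f (suc (suc h)) * (A x z * δ (d y z) (suc (suc h))))
      ≡⟨ Σv-linear₃ (f h) (f (suc h)) (f (suc (suc h))) (λ z → A x z * δ (d y z) h) (λ z → A x z * δ (d y z) (suc h)) (λ z → A x z * δ (d y z) (suc (suc h))) ⟩
    f h * Σv (λ z → A x z * δ (d y z) h) + f (suc h) * Σv (λ z → A x z * δ (d y z) (suc h))
      + f (suc (suc h)) * Σv (λ z → A x z * δ (d y z) (suc (suc h)))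
      ≡⟨ cong₂ _+_ (cong₂ _+_ (cong (f h *_) (Σv-Aδ x y h)) (cong (f (suc h) *_) (Σv-Aδ x y (suc h))))
                   (cong (f (suc (suc h)) *_) (Σv-Aδ x y (suc (suc h)))) ⟩
    f h * ℕ→ℚ (p (d x y) 1 h) + f (suc h) * ℕ→ℚ (p (d x y) 1 (suc h)) + f (suc (suc h)) * ℕ→ℚ (p (d x y) 1 (suc (suc h)))
      ≡⟨ cong (λ t → f h * ℕ→ℚ (p t 1 h) + f (suc h) * ℕ→ℚ (p t 1 (suc h)) + f (suc (suc h)) * ℕ→ℚ (p t 1 (suc (suc h)))) dxy ⟩
    f h * cℚ (suc h) + f (suc h) * aℚ (suc h) + f (suc (suc h)) * bℚ (suc h) ∎
    where
    open ≡-Reasoning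
    pointwise : ∀ z → A x z * f (d y z) ≡ f h * (A x z * δ (d y z) h) + f (suc h) * (A x z * δ (d y z) (suc h))
                                           + f (suc (suc h)) * (A x z * δ (d y z) (suc (suc h)))
    pointwise z with Graph.adj graph x z in xz
    ... | false = solve 7 (λ F f₀ f₁ f₂ δ₀ δ₁ δ₂ → con 0ℚ :* F := f₀ :* (con 0ℚ :* δ₀) :+ f₁ :* (con 0ℚ :* δ₁) :+ f₂ :* (con 0ℚ :* δ₂))
                    refl (f (d y z)) (f h) (f (suc h)) (f (suc (suc h))) (δ (d y z) h) (δ (d y z) (suc h)) (δ (d y z) (suc (suc h)))
    ... | true = trans (ℚP.*-identityˡ (f (d y z))) (trans (three-levels (d y z) h f h≤dyz dyz≤2+h)
                   (solve 6 (λ f₀ f₁ f₂ δ₀ δ₁ δ₂ → δ₀ :* f₀ :+ δ₁ :* f₁ :+ δ₂ :* f₂ := f₀ :* (con 1ℚ :* δ₀) :+ f₁ :* (con 1ℚ :* δ₁) :+ f₂ :* (con 1ℚ :* δ₂))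
                      refl (f h) (f (suc h)) (f (suc (suc h))) (δ (d y z) h) (δ (d y z) (suc h)) (δ (d y z) (suc (suc h)))))
      where
      xz′ : T (Graph.adj graph x z)
      xz′ = subst T (sym xz) _
      dyx : d y x ≡ suc h
      dyx = trans (dist-sym y x) dxy
      h≤dyz : h ≤ d y z
      h≤dyz = ℕP.≤-pred (subst (_≤ suc (d y z)) dyx (dist-adj (adj-sym xz′)))
      dyz≤2+h : d y z ≤ suc (suc h)
      dyz≤2+h = subst (λ t → d y z ≤ suc t) dyx (dist-adj xz′)

  neighbour-sum-self : ∀ x (f : ℕ → ℚ) → Σv (λ z → A x z * f (d x z)) ≡ f 1 * kℚ
  neighbour-sum-self x f = begin
    Σv (λ z → A x z * f (d x z))                  ≡⟨ Σv-cong pointwise ⟩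
    Σv (λ z → f 1 * (δ (d x z) 1 * δ (d x z) 1))  ≡⟨ Σv-*ˡ (f 1) (λ z → δ (d x z) 1 * δ (d x z) 1) ⟩
    f 1 * Σv (λ z → δ (d x z) 1 * δ (d x z) 1)    ≡⟨ cong (f 1 *_) (Σv-δδ x x 1 1) ⟩
    f 1 * ℕ→ℚ (p (d x x) 1 1)                     ≡⟨ cong (λ t → f 1 * ℕ→ℚ (p t 1 1)) (dist-refl x) ⟩
    f 1 * kℚ                                      ∎
    where
    open ≡-Reasoning
    pointwise : ∀ z → A x z * f (d x z) ≡ f 1 * (δ (d x z) 1 * δ (d x z) 1)
    pointwise z = begin
      A x z * f (d x z)                ≡⟨ cong (_* f (d x z)) (A≡δ1 x z) ⟩
      δ (d x z) 1 * f (d x z)          ≡⟨ δ-subst (d x z) 1 f ⟩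
      δ (d x z) 1 * f 1                ≡⟨ cong (_* f 1) (sym (δ-idem (d x z) 1)) ⟩
      δ (d x z) 1 * δ (d x z) 1 * f 1  ≡⟨ ℚP.*-comm (δ (d x z) 1 * δ (d x z) 1) (f 1) ⟩
      f 1 * (δ (d x z) 1 * δ (d x z) 1) ∎

  degree : ∀ x → Σv (A x) ≡ kℚ
  degree x = trans (Σv-cong (λ z → sym (ℚP.*-identityʳ (A x z)))) (trans (neighbour-sum-self x (λ _ → 1ℚ)) (ℚP.*-identityˡ kℚ))

  c+a+b≡k : ∀ h → suc h ≤ D → cℚ (suc h) + aℚ (suc h) + bℚ (suc h) ≡ kℚ
  c+a+b≡k h h<D = begin
    cℚ (suc h) + aℚ (suc h) + bℚ (suc h)                    ≡⟨ solve 3 (λ c a b → c :+ a :+ b := con 1ℚ :* c :+ con 1ℚ :* a :+ con 1ℚ :* b) refl (cℚ (suc h)) (aℚ (suc h)) (bℚ (suc h)) ⟩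
    1ℚ * cℚ (suc h) + 1ℚ * aℚ (suc h) + 1ℚ * bℚ (suc h)     ≡⟨ sym (neighbour-sum x₀ w (λ _ → 1ℚ) h dw) ⟩
    Σv (λ z → A x₀ z * 1ℚ)                                  ≡⟨ neighbour-sum-self x₀ (λ _ → 1ℚ) ⟩
    1ℚ * kℚ                                                 ≡⟨ ℚP.*-identityˡ kℚ ⟩
    kℚ                                                      ∎
    where
    open ≡-Reasoning
    w = vertex-at h h<D .proj₁
    dw = vertex-at h h<D .proj₂


  δ-dist-0 : ∀ x z → δ (d x z) 0 ≡ 𝟙 ⌊ x ≟ z ⌋
  δ-dist-0 x z = cong 𝟙 (T-ext (λ h → fromWitness (dist≡0⇒≡ (ℕP.≡ᵇ⇒≡ (d x z) 0 h)))
                                (λ h → subst (λ w → T (d x w ≡ᵇ 0)) (toWitness h) (subst (λ t → T (t ≡ᵇ 0)) (sym (dist-refl x)) _)))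

  c₁≡1 : cℚ 1 ≡ 1ℚ
  c₁≡1 = begin
    cℚ 1                                         ≡⟨ cong (λ t → ℕ→ℚ (p t 1 0)) (sym dw) ⟩
    ℕ→ℚ (p (d x₀ w) 1 0)                         ≡⟨ sym (Σv-δδ x₀ w 1 0) ⟩
    Σv (λ z → δ (d x₀ z) 1 * δ (d w z) 0)        ≡⟨ Σv-cong (λ z → trans (ℚP.*-comm (δ (d x₀ z) 1) (δ (d w z) 0)) (cong (_* δ (d x₀ z) 1) (δ-dist-0 w z))) ⟩
    Σv (λ z → 𝟙 ⌊ w ≟ z ⌋ * δ (d x₀ z) 1)        ≡⟨ Σv-point w (λ z → δ (d x₀ z) 1) ⟩
    δ (d x₀ w) 1                                 ≡⟨ cong (λ t → δ t 1) dw ⟩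
    δ 1 1                                        ∎
    where
    open ≡-Reasoning
    w = vertex-at 0 (ℕP.<-trans (s≤s z≤n) 1<D) .proj₁
    dw = vertex-at 0 (ℕP.<-trans (s≤s z≤n) 1<D) .proj₂

  Eigenvector : (Fin n → ℚ) → ℚ → Set
  Eigenvector v θ = ∀ x → (A · v) x ≡ θ * v x

  sphere : (Fin n → ℚ) → Fin n → ℕ → ℚ
  sphere v x i = Σv (λ z → δ (d x z) i * v z)

  sphere-0 : ∀ v x → sphere v x 0 ≡ v x
  sphere-0 v x = trans (Σv-cong (λ z → cong (_* v z) (δ-dist-0 x z))) (Σv-point x v)

  sphere-1 : ∀ v x → sphere v x 1 ≡ (A · v) x
  sphere-1 v x = Σv-cong (λ z → cong (_* v z) (sym (A≡δ1 x z)))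

  Σv≡sumTo-sphere : ∀ x (g : Fin n → ℚ) → Σv g ≡ sumTo D (sphere g x)
  Σv≡sumTo-sphere x g = sym (trans (sumTo-Σv D (λ i z → δ (d x z) i * g z))
                                   (Σv-cong (λ z → sumTo-δ D (d x z) (g z) (dist-≤-D x z))))

  A-sphere-indicator : ∀ x j w → Σv (λ z → A w z * δ (d x z) (suc j)) ≡
                       bℚ j * δ (d x w) j + aℚ (suc j) * δ (d x w) (suc j) + cℚ (suc (suc j)) * δ (d x w) (suc (suc j))
  A-sphere-indicator x j w = by-distance (d w x) refl
    where
    open ≡-Reasoning
    goal : Fin n → Set
    goal x = Σv (λ z → A w z * δ (d x z) (suc j)) ≡
             bℚ j * δ (d x w) j + aℚ (suc j) * δ (d x w) (suc j) + cℚ (suc (suc j)) * δ (d x w) (suc (suc j))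
    by-distance : ∀ m → d w x ≡ m → goal x
    by-distance zero dwx = subst goal (dist≡0⇒≡ dwx) (begin
      Σv (λ z → A w z * δ (d w z) (suc j))   ≡⟨ neighbour-sum-self w (λ m → δ m (suc j)) ⟩
      δ 1 (suc j) * bℚ 0                     ≡⟨ δ-subst 0 j bℚ ⟩
      δ 0 j * bℚ j                           ≡⟨ solve 4 (λ δ₀ b a c → δ₀ :* b := b :* δ₀ :+ a :* con 0ℚ :+ c :* con 0ℚ) refl (δ 0 j) (bℚ j) (aℚ (suc j)) (cℚ (suc (suc j))) ⟩
      bℚ j * δ 0 j + aℚ (suc j) * 0ℚ + cℚ (suc (suc j)) * 0ℚ
        ≡⟨ cong (λ t → bℚ j * δ t j + aℚ (suc j) * δ t (suc j) + cℚ (suc (suc j)) * δ t (suc (suc j))) (sym (dist-refl w)) ⟩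
      bℚ j * δ (d w w) j + aℚ (suc j) * δ (d w w) (suc j) + cℚ (suc (suc j)) * δ (d w w) (suc (suc j)) ∎)
    by-distance (suc h) dwx = begin
      Σv (λ z → A w z * δ (d x z) (suc j))
        ≡⟨ neighbour-sum w x (λ m → δ m (suc j)) h dwx ⟩
      δ h (suc j) * cℚ (suc h) + δ (suc h) (suc j) * aℚ (suc h) + δ (suc (suc h)) (suc j) * bℚ (suc h)
        ≡⟨ cong₂ _+_ (cong₂ _+_ (δ-subst (suc h) (suc (suc j)) cℚ) (δ-subst (suc h) (suc j) aℚ)) (δ-subst (suc h) j bℚ) ⟩
      δ (suc h) (suc (suc j)) * cℚ (suc (suc j)) + δ (suc h) (suc j) * aℚ (suc j) + δ (suc h) j * bℚ j
        ≡⟨ solve 6 (λ δ₂ c δ₁ a δ₀ b → δ₂ :* c :+ δ₁ :* a :+ δ₀ :* b := b :* δ₀ :+ a :* δ₁ :+ c :* δ₂) refl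
             (δ (suc h) (suc (suc j))) (cℚ (suc (suc j))) (δ (suc h) (suc j)) (aℚ (suc j)) (δ (suc h) j) (bℚ j) ⟩
      bℚ j * δ (suc h) j + aℚ (suc j) * δ (suc h) (suc j) + cℚ (suc (suc j)) * δ (suc h) (suc (suc j))
        ≡⟨ cong (λ t → bℚ j * δ t j + aℚ (suc j) * δ t (suc j) + cℚ (suc (suc j)) * δ t (suc (suc j))) (trans (sym dwx) (dist-sym w x)) ⟩
      bℚ j * δ (d x w) j + aℚ (suc j) * δ (d x w) (suc j) + cℚ (suc (suc j)) * δ (d x w) (suc (suc j)) ∎

  sphere-recurrence : ∀ v θ → Eigenvector v θ → ∀ x j →
    θ * sphere v x (suc j) ≡ bℚ j * sphere v x j + aℚ (suc j) * sphere v x (suc j) + cℚ (suc (suc j)) * sphere v x (suc (suc j))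
  sphere-recurrence v θ eigen x j = begin
    θ * sphere v x (suc j)                                   ≡⟨ sym (Σv-*ˡ θ (λ z → δ (d x z) (suc j) * v z)) ⟩
    Σv (λ z → θ * (δ (d x z) (suc j) * v z))                 ≡⟨ Σv-cong (λ z → solve 3 (λ t a b → t :* (a :* b) := a :* (t :* b)) refl θ (δ (d x z) (suc j)) (v z)) ⟩
    Σv (λ z → δ (d x z) (suc j) * (θ * v z))                 ≡⟨ Σv-cong (λ z → cong (δ (d x z) (suc j) *_) (sym (eigen z))) ⟩
    Σv (λ z → δ (d x z) (suc j) * Σv (λ w → A z w * v w))    ≡⟨ Σv-cong (λ z → sym (Σv-*ˡ (δ (d x z) (suc j)) (λ w → A z w * v w))) ⟩
    Σv (λ z → Σv (λ w → δ (d x z) (suc j) * (A z w * v w)))  ≡⟨ Σv-swap (λ z w → δ (d x z) (suc j) * (A z w * v w)) ⟩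
    Σv (λ w → Σv (λ z → δ (d x z) (suc j) * (A z w * v w)))  ≡⟨ Σv-cong inner ⟩
    Σv (λ w → bℚ j * (δ (d x w) j * v w) + aℚ (suc j) * (δ (d x w) (suc j) * v w) + cℚ (suc (suc j)) * (δ (d x w) (suc (suc j)) * v w))
      ≡⟨ Σv-linear₃ (bℚ j) (aℚ (suc j)) (cℚ (suc (suc j))) (λ w → δ (d x w) j * v w) (λ w → δ (d x w) (suc j) * v w) (λ w → δ (d x w) (suc (suc j)) * v w) ⟩
    bℚ j * sphere v x j + aℚ (suc j) * sphere v x (suc j) + cℚ (suc (suc j)) * sphere v x (suc (suc j)) ∎
    where
    open ≡-Reasoning
    inner : ∀ w → Σv (λ z → δ (d x z) (suc j) * (A z w * v w)) ≡
                  bℚ j * (δ (d x w) j * v w) + aℚ (suc j) * (δ (d x w) (suc j) * v w) + cℚ (suc (suc j)) * (δ (d x w) (suc (suc j)) * v w)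
    inner w = begin
      Σv (λ z → δ (d x z) (suc j) * (A z w * v w))
        ≡⟨ Σv-cong (λ z → trans (cong (λ t → δ (d x z) (suc j) * (𝟙 t * v w)) (Graph.sym graph z w))
                                (solve 3 (λ a b c → a :* (b :* c) := c :* (b :* a)) refl (δ (d x z) (suc j)) (A w z) (v w))) ⟩
      Σv (λ z → v w * (A w z * δ (d x z) (suc j)))    ≡⟨ Σv-*ˡ (v w) (λ z → A w z * δ (d x z) (suc j)) ⟩
      v w * Σv (λ z → A w z * δ (d x z) (suc j))      ≡⟨ cong (v w *_) (A-sphere-indicator x j w) ⟩
      v w * (bℚ j * δ (d x w) j + aℚ (suc j) * δ (d x w) (suc j) + cℚ (suc (suc j)) * δ (d x w) (suc (suc j)))
        ≡⟨ solve 7 (λ v b δ₀ a δ₁ c δ₂ → v :* (b :* δ₀ :+ a :* δ₁ :+ c :* δ₂) := b :* (δ₀ :* v) :+ a :* (δ₁ :* v) :+ c :* (δ₂ :* v))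
             refl (v w) (bℚ j) (δ (d x w) j) (aℚ (suc j)) (δ (d x w) (suc j)) (cℚ (suc (suc j))) (δ (d x w) (suc (suc j))) ⟩
      bℚ j * (δ (d x w) j * v w) + aℚ (suc j) * (δ (d x w) (suc j) * v w) + cℚ (suc (suc j)) * (δ (d x w) (suc (suc j)) * v w) ∎

  -- kᵢ = |Γᵢ(x)|
  kᵢ : ℕ → ℚ
  kᵢ i = ℕ→ℚ (p 0 i i)

  sphere-ones : ∀ x i → sphere (λ _ → 1ℚ) x i ≡ kᵢ i
  sphere-ones x i = begin
    Σv (λ z → δ (d x z) i * 1ℚ)             ≡⟨ Σv-cong (λ z → trans (ℚP.*-identityʳ (δ (d x z) i)) (sym (δ-idem (d x z) i))) ⟩
    Σv (λ z → δ (d x z) i * δ (d x z) i)    ≡⟨ Σv-δδ x x i i ⟩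
    ℕ→ℚ (p (d x x) i i)                     ≡⟨ cong (λ t → ℕ→ℚ (p t i i)) (dist-refl x) ⟩
    kᵢ i                                    ∎
    where open ≡-Reasoning

  k₀≡1 : kᵢ 0 ≡ 1ℚ
  k₀≡1 = trans (sym (sphere-ones x₀ 0)) (sphere-0 (λ _ → 1ℚ) x₀)

  kᵢ-nonNeg : ∀ i → 0ℚ ℚ.≤ kᵢ i
  kᵢ-nonNeg i = ℕ→ℚ-nonNeg (p 0 i i)

  ones-eigenvector : Eigenvector (λ _ → 1ℚ) kℚ
  ones-eigenvector x = trans (Σv-cong (λ z → ℚP.*-identityʳ (A x z))) (trans (degree x) (sym (ℚP.*-identityʳ kℚ)))

  kᵢbᵢ≡kᵢ₊₁cᵢ₊₁ : ∀ i → suc i ≤ D → kᵢ i * bℚ i ≡ kᵢ (suc i) * cℚ (suc i)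
  kᵢbᵢ≡kᵢ₊₁cᵢ₊₁ zero _ = begin
    kᵢ 0 * bℚ 0    ≡⟨ cong (_* kℚ) k₀≡1 ⟩
    1ℚ * kℚ        ≡⟨ ℚP.*-comm 1ℚ kℚ ⟩
    kℚ * 1ℚ        ≡⟨ cong (kℚ *_) (sym c₁≡1) ⟩
    kᵢ 1 * cℚ 1    ∎
    where open ≡-Reasoning
  kᵢbᵢ≡kᵢ₊₁cᵢ₊₁ (suc j) 2+j≤D = begin
    kᵢ (suc j) * bℚ (suc j)
      ≡⟨ solve 5 (λ k₁ a b c c₂ → k₁ :* b := (c :+ a :+ b) :* k₁ :- a :* k₁ :- c :* k₁) refl (kᵢ (suc j)) (aℚ (suc j)) (bℚ (suc j)) (cℚ (suc j)) (cℚ (suc (suc j))) ⟩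
    (cℚ (suc j) + aℚ (suc j) + bℚ (suc j)) * kᵢ (suc j) - aℚ (suc j) * kᵢ (suc j) - cℚ (suc j) * kᵢ (suc j)
      ≡⟨ cong (λ t → t * kᵢ (suc j) - aℚ (suc j) * kᵢ (suc j) - cℚ (suc j) * kᵢ (suc j)) (c+a+b≡k j 1+j≤D) ⟩
    kℚ * kᵢ (suc j) - aℚ (suc j) * kᵢ (suc j) - cℚ (suc j) * kᵢ (suc j)
      ≡⟨ cong (λ t → t - aℚ (suc j) * kᵢ (suc j) - cℚ (suc j) * kᵢ (suc j)) ones-recurrence ⟩
    bℚ j * kᵢ j + aℚ (suc j) * kᵢ (suc j) + cℚ (suc (suc j)) * kᵢ (suc (suc j)) - aℚ (suc j) * kᵢ (suc j) - cℚ (suc j) * kᵢ (suc j)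
      ≡⟨ solve 7 (λ b₀ k₀ a k₁ c₂ k₂ c₁ → b₀ :* k₀ :+ a :* k₁ :+ c₂ :* k₂ :- a :* k₁ :- c₁ :* k₁ := k₀ :* b₀ :+ c₂ :* k₂ :- k₁ :* c₁)
           refl (bℚ j) (kᵢ j) (aℚ (suc j)) (kᵢ (suc j)) (cℚ (suc (suc j))) (kᵢ (suc (suc j))) (cℚ (suc j)) ⟩
    kᵢ j * bℚ j + cℚ (suc (suc j)) * kᵢ (suc (suc j)) - kᵢ (suc j) * cℚ (suc j)
      ≡⟨ cong (λ t → t + cℚ (suc (suc j)) * kᵢ (suc (suc j)) - kᵢ (suc j) * cℚ (suc j)) (kᵢbᵢ≡kᵢ₊₁cᵢ₊₁ j 1+j≤D) ⟩
    kᵢ (suc j) * cℚ (suc j) + cℚ (suc (suc j)) * kᵢ (suc (suc j)) - kᵢ (suc j) * cℚ (suc j)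
      ≡⟨ solve 4 (λ a b c e → a :* b :+ c :* e :- a :* b := e :* c) refl (kᵢ (suc j)) (cℚ (suc j)) (cℚ (suc (suc j))) (kᵢ (suc (suc j))) ⟩
    kᵢ (suc (suc j)) * cℚ (suc (suc j)) ∎
    where
    open ≡-Reasoning
    1+j≤D : suc j ≤ D
    1+j≤D = ℕP.<⇒≤ 2+j≤D
    ones-recurrence : kℚ * kᵢ (suc j) ≡ bℚ j * kᵢ j + aℚ (suc j) * kᵢ (suc j) + cℚ (suc (suc j)) * kᵢ (suc (suc j))
    ones-recurrence = begin
      kℚ * kᵢ (suc j)                    ≡⟨ cong (kℚ *_) (sym (sphere-ones x₀ (suc j))) ⟩
      kℚ * sphere (λ _ → 1ℚ) x₀ (suc j)  ≡⟨ sphere-recurrence (λ _ → 1ℚ) kℚ ones-eigenvector x₀ j ⟩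
      bℚ j * sphere (λ _ → 1ℚ) x₀ j + aℚ (suc j) * sphere (λ _ → 1ℚ) x₀ (suc j) + cℚ (suc (suc j)) * sphere (λ _ → 1ℚ) x₀ (suc (suc j))
        ≡⟨ cong₂ _+_ (cong₂ _+_ (cong (bℚ j *_) (sphere-ones x₀ j)) (cong (aℚ (suc j) *_) (sphere-ones x₀ (suc j))))
                     (cong (cℚ (suc (suc j)) *_) (sphere-ones x₀ (suc (suc j)))) ⟩
      bℚ j * kᵢ j + aℚ (suc j) * kᵢ (suc j) + cℚ (suc (suc j)) * kᵢ (suc (suc j)) ∎

  module StandardSequence (θ : ℚ) where

    u : ℕ → ℚ
    u = stdSeq Γ θ

    -- the eigenvalue equation for x ↦ u (d y x) at a vertex x with d y x = j + 1
    EigenEquation : ℕ → Set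
    EigenEquation j = u j * cℚ (suc j) + u (suc j) * aℚ (suc j) + u (suc (suc j)) * bℚ (suc j) ≡ θ * u (suc j)

    k*u₁≡θ : kℚ * u 1 ≡ θ
    k*u₁≡θ = ℕ→ℚ-*-/ℕ k θ (b≢0 0 (ℕP.<-trans (s≤s z≤n) 1<D))

    stdSeq-recurrence : ∀ j → suc (suc j) ≤ D →
                        bℚ (suc j) * u (suc (suc j)) ≡ θ * u (suc j) - cℚ (suc j) * u j - aℚ (suc j) * u (suc j)
    stdSeq-recurrence j 2+j≤D = ℕ→ℚ-*-/ℕ (b (suc j)) _ (b≢0 (suc j) 2+j≤D)

    eigenEquation : ∀ j → suc (suc j) ≤ D → EigenEquation j
    eigenEquation j 2+j≤D = begin
      u j * C + u (suc j) * A′ + u (suc (suc j)) * B      ≡⟨ cong (_+_ (u j * C + u (suc j) * A′)) (trans (ℚP.*-comm (u (suc (suc j))) B) (stdSeq-recurrence j 2+j≤D)) ⟩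
      u j * C + u (suc j) * A′ + (θ * u (suc j) - C * u j - A′ * u (suc j))
        ≡⟨ solve 5 (λ u₀ C u₁ A θ → u₀ :* C :+ u₁ :* A :+ (θ :* u₁ :- C :* u₀ :- A :* u₁) := θ :* u₁) refl (u j) C (u (suc j)) A′ θ ⟩
      θ * u (suc j)                                        ∎
      where
      open ≡-Reasoning
      C A′ B : ℚ
      C = cℚ (suc j)
      A′ = aℚ (suc j)
      B = bℚ (suc j)

    module Closed (closing : ∀ j → suc j ≡ D → EigenEquation j) where

      eigenEquation-≤D : ∀ j → suc j ≤ D → EigenEquation j
      eigenEquation-≤D j j<D = [ eigenEquation j , closing j ]′ (ℕP.m≤n⇒m<n∨m≡n j<D)

      column-eigenvector : ∀ y → Eigenvector (λ z → u (d y z)) θ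
      column-eigenvector y x = by-distance (d x y) refl
        where
        open ≡-Reasoning
        by-distance : ∀ m → d x y ≡ m → (A · (λ z → u (d y z))) x ≡ θ * u (d y x)
        by-distance zero dxy = subst (λ y → (A · (λ z → u (d y z))) x ≡ θ * u (d y x)) (dist≡0⇒≡ dxy) (begin
          Σv (λ z → A x z * u (d x z))   ≡⟨ neighbour-sum-self x u ⟩
          u 1 * kℚ                        ≡⟨ trans (ℚP.*-comm (u 1) kℚ) k*u₁≡θ ⟩
          θ                               ≡⟨ sym (ℚP.*-identityʳ θ) ⟩
          θ * u 0                         ≡⟨ cong (λ t → θ * u t) (sym (dist-refl x)) ⟩
          θ * u (d x x)                   ∎)
        by-distance (suc h) dxy = begin
          Σv (λ z → A x z * u (d y z))                                                ≡⟨ neighbour-sum x y u h dxy ⟩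
          u h * cℚ (suc h) + u (suc h) * aℚ (suc h) + u (suc (suc h)) * bℚ (suc h)   ≡⟨ eigenEquation-≤D h (subst (_≤ D) dxy (dist-≤-D x y)) ⟩
          θ * u (suc h)                                                               ≡⟨ cong (λ t → θ * u t) (trans (sym dxy) (dist-sym x y)) ⟩
          θ * u (d y x)                                                               ∎

      private
        module SphereValues (v : Fin n → ℚ) (eigen : Eigenvector v θ) (x : Fin n) where
          S S′ : ℕ → ℚ
          S = sphere v x
          S′ i = kᵢ i * u i * v x

          -- c₂ S₂ = θ S₁ − b₀ S₀ − a₁ S₁ by the sphere recurrence, and S′ obeys the same relation
          -- by the recurrence of u together with k₀ b₀ = k₁ c₁ and k₁ b₁ = k₂ c₂.
          next : ∀ j → suc (suc j) ≤ D → S j ≡ S′ j → S (suc j) ≡ S′ (suc j) → S (suc (suc j)) ≡ S′ (suc (suc j))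
          next j 2+j≤D S₀≡S′₀ S₁≡S′₁ = *-cancelˡ-≢0 (ℕ→ℚ-≢0 (c≢0 (suc j) 2+j≤D)) (begin
            c₂ * S (suc (suc j))
              ≡⟨ solve 4 (λ X Y Z W → W := (X :+ Y :+ W) :- X :- Y) refl (b₀ * S′ j) (a₁ * S′ (suc j)) (S (suc (suc j))) (c₂ * S (suc (suc j))) ⟩
            b₀ * S′ j + a₁ * S′ (suc j) + c₂ * S (suc (suc j)) - b₀ * S′ j - a₁ * S′ (suc j)
              ≡⟨ cong (λ t → t - b₀ * S′ j - a₁ * S′ (suc j)) (sym recurrence) ⟩
            θ * S′ (suc j) - b₀ * S′ j - a₁ * S′ (suc j)
              ≡⟨ solve 8 (λ θ k₁ u₁ w b₀ k₀ u₀ a₁ → θ :* (k₁ :* u₁ :* w) :- b₀ :* (k₀ :* u₀ :* w) :- a₁ :* (k₁ :* u₁ :* w)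
                   := θ :* k₁ :* u₁ :* w :- (k₀ :* b₀) :* u₀ :* w :- a₁ :* k₁ :* u₁ :* w) refl θ k₁ (u (suc j)) (v x) b₀ k₀ (u j) a₁ ⟩
            θ * k₁ * u (suc j) * v x - (k₀ * b₀) * u j * v x - a₁ * k₁ * u (suc j) * v x
              ≡⟨ cong (λ t → θ * k₁ * u (suc j) * v x - t * u j * v x - a₁ * k₁ * u (suc j) * v x) (kᵢbᵢ≡kᵢ₊₁cᵢ₊₁ j (ℕP.<⇒≤ 2+j≤D)) ⟩
            θ * k₁ * u (suc j) * v x - (k₁ * c₁) * u j * v x - a₁ * k₁ * u (suc j) * v x
              ≡⟨ solve 7 (λ θ k₁ u₁ w c₁ u₀ a₁ → θ :* k₁ :* u₁ :* w :- (k₁ :* c₁) :* u₀ :* w :- a₁ :* k₁ :* u₁ :* w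
                   := k₁ :* (θ :* u₁ :- c₁ :* u₀ :- a₁ :* u₁) :* w) refl θ k₁ (u (suc j)) (v x) c₁ (u j) a₁ ⟩
            k₁ * (θ * u (suc j) - c₁ * u j - a₁ * u (suc j)) * v x
              ≡⟨ cong (λ t → k₁ * t * v x) (sym (stdSeq-recurrence j 2+j≤D)) ⟩
            k₁ * (b₁ * u (suc (suc j))) * v x
              ≡⟨ solve 4 (λ a b c w → a :* (b :* c) :* w := (a :* b) :* c :* w) refl k₁ b₁ (u (suc (suc j))) (v x) ⟩
            (k₁ * b₁) * u (suc (suc j)) * v x
              ≡⟨ cong (λ t → t * u (suc (suc j)) * v x) (kᵢbᵢ≡kᵢ₊₁cᵢ₊₁ (suc j) 2+j≤D) ⟩
            (kᵢ (suc (suc j)) * c₂) * u (suc (suc j)) * v x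
              ≡⟨ solve 4 (λ a b c w → (a :* b) :* c :* w := b :* (a :* c :* w)) refl (kᵢ (suc (suc j))) c₂ (u (suc (suc j))) (v x) ⟩
            c₂ * S′ (suc (suc j)) ∎)
            where
            open ≡-Reasoning
            k₀ k₁ b₀ b₁ c₁ c₂ a₁ : ℚ
            k₀ = kᵢ j
            k₁ = kᵢ (suc j)
            b₀ = bℚ j
            b₁ = bℚ (suc j)
            c₁ = cℚ (suc j)
            c₂ = cℚ (suc (suc j))
            a₁ = aℚ (suc j)
            recurrence : θ * S′ (suc j) ≡ b₀ * S′ j + a₁ * S′ (suc j) + c₂ * S (suc (suc j))
            recurrence = begin
              θ * S′ (suc j)                                        ≡⟨ cong (θ *_) (sym S₁≡S′₁) ⟩
              θ * S (suc j)                                        ≡⟨ sphere-recurrence v θ eigen x j ⟩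
              b₀ * S j + a₁ * S (suc j) + c₂ * S (suc (suc j))     ≡⟨ cong₂ (λ s t → b₀ * s + a₁ * t + c₂ * S (suc (suc j))) S₀≡S′₀ S₁≡S′₁ ⟩
              b₀ * S′ j + a₁ * S′ (suc j) + c₂ * S (suc (suc j))     ∎

          consecutive : ∀ j → suc j ≤ D → (S j ≡ S′ j) × (S (suc j) ≡ S′ (suc j))
          consecutive zero    _ = S₀ , S₁
            where
            open ≡-Reasoning
            S₀ : S 0 ≡ S′ 0
            S₀ = begin
              S 0               ≡⟨ sphere-0 v x ⟩
              v x               ≡⟨ sym (ℚP.*-identityˡ (v x)) ⟩
              1ℚ * 1ℚ * v x     ≡⟨ cong (λ t → t * 1ℚ * v x) (sym k₀≡1) ⟩
              S′ 0               ∎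
            S₁ : S 1 ≡ S′ 1
            S₁ = begin
              S 1               ≡⟨ sphere-1 v x ⟩
              (A · v) x         ≡⟨ eigen x ⟩
              θ * v x           ≡⟨ cong (_* v x) (sym k*u₁≡θ) ⟩
              S′ 1               ∎
          consecutive (suc j) 2+j≤D =
            let Sj≡S′j , S₁≡S′₁ = consecutive j (ℕP.<⇒≤ 2+j≤D) in S₁≡S′₁ , next j 2+j≤D Sj≡S′j S₁≡S′₁

      sphere-eigenvector : ∀ v → Eigenvector v θ → ∀ x i → i ≤ D → sphere v x i ≡ kᵢ i * u i * v x
      sphere-eigenvector v eigen x zero    _   = consecutive 0 (ℕP.<-trans (s≤s z≤n) 1<D) .proj₁
        where open SphereValues v eigen x
      sphere-eigenvector v eigen x (suc j) j<D = consecutive j j<D .proj₂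
        where open SphereValues v eigen x


      M : Fin n → Fin n → ℚ
      M x y = u (d x y)

      κ : ℚ
      κ = sumTo D (λ i → kᵢ i * u i * u i)

      M-sym : ∀ x y → M x y ≡ M y x
      M-sym x y = cong u (dist-sym x y)

      M-eigenvector : ∀ v → Eigenvector v θ → ∀ x → (M · v) x ≡ κ * v x
      M-eigenvector v eigen x = begin
        Σv (λ z → u (d x z) * v z)                                  ≡⟨ Σv≡sumTo-sphere x (λ z → u (d x z) * v z) ⟩
        sumTo D (λ i → Σv (λ z → δ (d x z) i * (u (d x z) * v z)))  ≡⟨ sumTo-cong D (λ i _ → Σv-cong (λ z → on-sphere i z)) ⟩
        sumTo D (λ i → Σv (λ z → u i * (δ (d x z) i * v z)))        ≡⟨ sumTo-cong D (λ i _ → Σv-*ˡ (u i) (λ z → δ (d x z) i * v z)) ⟩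
        sumTo D (λ i → u i * sphere v x i)                          ≡⟨ sumTo-cong D (λ i i≤D → trans (cong (u i *_) (sphere-eigenvector v eigen x i i≤D))
                                                                         (solve 3 (λ u k w → u :* (k :* u :* w) := w :* (k :* u :* u)) refl (u i) (kᵢ i) (v x))) ⟩
        sumTo D (λ i → v x * (kᵢ i * u i * u i))                    ≡⟨ sumTo-*ˡ D (v x) (λ i → kᵢ i * u i * u i) ⟩
        v x * κ                                                     ≡⟨ ℚP.*-comm (v x) κ ⟩
        κ * v x                                                     ∎
        where
        open ≡-Reasoning
        on-sphere : ∀ i z → δ (d x z) i * (u (d x z) * v z) ≡ u i * (δ (d x z) i * v z)
        on-sphere i z = begin
          δ (d x z) i * (u (d x z) * v z)  ≡⟨ sym (ℚP.*-assoc (δ (d x z) i) (u (d x z)) (v z)) ⟩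
          δ (d x z) i * u (d x z) * v z    ≡⟨ cong (_* v z) (δ-subst (d x z) i u) ⟩
          δ (d x z) i * u i * v z          ≡⟨ solve 3 (λ a b c → a :* b :* c := b :* (a :* c)) refl (δ (d x z) i) (u i) (v z) ⟩
          u i * (δ (d x z) i * v z)        ∎

      M²≡κM : ∀ x z → Σv (λ y → M x y * M y z) ≡ κ * M x z
      M²≡κM x z = begin
        Σv (λ y → M x y * M y z)     ≡⟨ Σv-cong (λ y → cong (M x y *_) (M-sym y z)) ⟩
        (M · (λ y → u (d z y))) x    ≡⟨ M-eigenvector (λ y → u (d z y)) (column-eigenvector z) x ⟩
        κ * M z x                    ≡⟨ cong (κ *_) (M-sym z x) ⟩
        κ * M x z                    ∎
        where open ≡-Reasoning

      -- the columns of M are θ-eigenvectors of the symmetric matrix A, hence orthogonal to its k-eigenvector 1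
      M-rowSum : θ ≢ kℚ → ∀ x → Σv (M x) ≡ 0ℚ
      M-rowSum θ≢k x = *-cancelˡ-≢0 θ-k≢0 (begin
        (θ - kℚ) * W                   ≡⟨ solve 3 (λ t k w → (t :- k) :* w := t :* w :- k :* w) refl θ kℚ W ⟩
        θ * W - kℚ * W                 ≡⟨ cong₂ _-_ θW≡ΣAM kW≡ΣAM ⟩
        ΣAM - ΣAM                      ≡⟨ ℚP.+-inverseʳ ΣAM ⟩
        0ℚ                             ≡⟨ sym (ℚP.*-zeroʳ (θ - kℚ)) ⟩
        (θ - kℚ) * 0ℚ                  ∎)
        where
        open ≡-Reasoning
        W ΣAM : ℚ
        W = Σv (M x)
        ΣAM = Σv (λ y → Σv (λ z → A y z * M x z))
        θ-k≢0 : θ - kℚ ≢ 0ℚ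
        θ-k≢0 e = θ≢k (trans (solve 2 (λ t k → t := (t :- k) :+ k) refl θ kℚ) (trans (cong (_+ kℚ) e) (ℚP.+-identityˡ kℚ)))
        θW≡ΣAM : θ * W ≡ ΣAM
        θW≡ΣAM = trans (sym (Σv-*ˡ θ (M x))) (Σv-cong (λ y → sym (column-eigenvector x y)))
        kW≡ΣAM : kℚ * W ≡ ΣAM
        kW≡ΣAM = sym (begin
          ΣAM                                    ≡⟨ Σv-swap (λ y z → A y z * M x z) ⟩
          Σv (λ z → Σv (λ y → A y z * M x z))    ≡⟨ Σv-cong (λ z → trans (Σv-cong (λ y → trans (cong (λ t → 𝟙 t * M x z) (Graph.sym graph y z))
                                                                                    (ℚP.*-comm (A z y) (M x z))))
                                                                 (Σv-*ˡ (M x z) (A z))) ⟩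
          Σv (λ z → M x z * Σv (A z))            ≡⟨ Σv-cong (λ z → trans (cong (M x z *_) (degree z)) (ℚP.*-comm (M x z) kℚ)) ⟩
          Σv (λ z → kℚ * M x z)                  ≡⟨ Σv-*ˡ kℚ (M x) ⟩
          kℚ * W                                 ∎)

      1≤κ : 1ℚ ℚ.≤ κ
      1≤κ = subst (ℚ._≤ κ) (cong (λ t → t * 1ℚ * 1ℚ) k₀≡1)
              (sumTo-≥-head D (λ i → kᵢ i * u i * u i) (λ i → subst (0ℚ ℚ.≤_) (sym (ℚP.*-assoc (kᵢ (suc i)) (u (suc i)) (u (suc i))))
                (nonNeg-* (kᵢ-nonNeg (suc i)) (square-nonNeg (u (suc i))))))

-- Classical parameters

-- With Y = [j], so that [j+1] = 1 + B Y, this is bⱼ₊₁ = b₀ Bʲ⁺¹ + (b₁ − B − b₀ B) [j+1] + B cⱼ₊₁.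
b-expansion : ∀ (Δ β α B Y : ℚ) →
  (Δ - (1ℚ + B * Y)) * (β - α * (1ℚ + B * Y)) ≡
  ((Δ - 0ℚ) * (β - α * 0ℚ)) * (1ℚ + (B - 1ℚ) * (1ℚ + B * Y))
  + (((Δ - (1ℚ + B * 0ℚ)) * (β - α * (1ℚ + B * 0ℚ))) - B - ((Δ - 0ℚ) * (β - α * 0ℚ)) * B) * (1ℚ + B * Y)
  + B * ((1ℚ + B * Y) * (1ℚ + α * Y))
b-expansion = solve 5 (λ Δ β α B Y →
  (Δ :- (con 1ℚ :+ B :* Y)) :* (β :- α :* (con 1ℚ :+ B :* Y)) :=
  ((Δ :- con 0ℚ) :* (β :- α :* con 0ℚ)) :* (con 1ℚ :+ (B :- con 1ℚ) :* (con 1ℚ :+ B :* Y))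
  :+ (((Δ :- (con 1ℚ :+ B :* con 0ℚ)) :* (β :- α :* (con 1ℚ :+ B :* con 0ℚ))) :- B :- ((Δ :- con 0ℚ) :* (β :- α :* con 0ℚ)) :* B) :* (con 1ℚ :+ B :* Y)
  :+ B :* ((con 1ℚ :+ B :* Y) :* (con 1ℚ :+ α :* Y))) refl

-- One step of the induction for the standard sequence: b′ u₂ = θ u₁ − c u₀ − a u₁ with θ = k + k e,
-- a = k − c − b′ and b′ = k B P + k e B [j+1] + B c turns the invariant at j into the one at j+1.
difference-step : ∀ (k e B c b′ P u₀ u₁ u₂ Y : ℚ) →
  b′ * u₂ ≡ (k + k * e) * u₁ - c * u₀ - (k - c - b′) * u₁ →
  (u₁ - u₀) * P ≡ e → u₁ * P ≡ P + e * Y →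
  b′ ≡ k * (B * P) + (k * e * B) * Y + B * c →
  b′ * ((u₂ - u₁) * (B * P)) ≡ b′ * e
difference-step k e B c b′ P u₀ u₁ u₂ Y recurrence Δ₀ value₁ b′≡ = begin
  b′ * ((u₂ - u₁) * (B * P))
    ≡⟨ solve 5 (λ b′ u₂ u₁ B P → b′ :* ((u₂ :- u₁) :* (B :* P)) := (B :* P) :* (b′ :* u₂) :- B :* b′ :* (u₁ :* P)) refl b′ u₂ u₁ B P ⟩
  (B * P) * (b′ * u₂) - B * b′ * (u₁ * P)
    ≡⟨ cong (λ t → (B * P) * t - B * b′ * (u₁ * P)) recurrence ⟩
  (B * P) * ((k + k * e) * u₁ - c * u₀ - (k - c - b′) * u₁) - B * b′ * (u₁ * P)
    ≡⟨ solve 8 (λ k e B c b′ P u₀ u₁ →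
         (B :* P) :* ((k :+ k :* e) :* u₁ :- c :* u₀ :- (k :- c :- b′) :* u₁) :- B :* b′ :* (u₁ :* P)
         := B :* k :* e :* (u₁ :* P) :+ B :* c :* ((u₁ :- u₀) :* P)) refl k e B c b′ P u₀ u₁ ⟩
  B * k * e * (u₁ * P) + B * c * ((u₁ - u₀) * P)
    ≡⟨ cong₂ (λ s t → B * k * e * s + B * c * t) value₁ Δ₀ ⟩
  B * k * e * (P + e * Y) + B * c * e
    ≡⟨ solve 6 (λ k e B c P Y → B :* k :* e :* (P :+ e :* Y) :+ B :* c :* e := (k :* (B :* P) :+ (k :* e :* B) :* Y :+ B :* c) :* e) refl k e B c P Y ⟩
  (k * (B * P) + (k * e * B) * Y + B * c) * e
    ≡⟨ cong (_* e) (sym b′≡) ⟩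
  b′ * e ∎
  where open ≡-Reasoning

value-step : ∀ (e B P u₁ u₂ Y : ℚ) → (u₂ - u₁) * (B * P) ≡ e → u₁ * P ≡ P + e * Y →
             u₂ * (B * P) ≡ B * P + e * (1ℚ + B * Y)
value-step e B P u₁ u₂ Y Δ₁ value₁ = begin
  u₂ * (B * P)                  ≡⟨ solve 4 (λ u₂ u₁ B P → u₂ :* (B :* P) := (u₂ :- u₁) :* (B :* P) :+ B :* (u₁ :* P)) refl u₂ u₁ B P ⟩
  (u₂ - u₁) * (B * P) + B * (u₁ * P) ≡⟨ cong₂ (λ s t → s + B * t) Δ₁ value₁ ⟩
  e + B * (P + e * Y)           ≡⟨ solve 4 (λ e B P Y → e :+ B :* (P :+ e :* Y) := B :* P :+ e :* (con 1ℚ :+ B :* Y)) refl e B P Y ⟩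
  B * P + e * (1ℚ + B * Y)      ∎
  where open ≡-Reasoning

closing-step : ∀ (k e B c P u₀ u₁ Y : ℚ) → (u₁ - u₀) * P ≡ e → u₁ * P ≡ P + e * Y →
  0ℚ ≡ k * (B * P) + (k * e * B) * Y + B * c →
  (B * P) * (u₀ * c + u₁ * (k - c - 0ℚ)) ≡ (B * P) * ((k + k * e) * u₁)
closing-step k e B c P u₀ u₁ Y Δ₀ value₁ 0≡b′ = begin
  (B * P) * (u₀ * c + u₁ * (k - c - 0ℚ))
    ≡⟨ solve 7 (λ k e B c P u₀ u₁ → (B :* P) :* (u₀ :* c :+ u₁ :* (k :- c :- con 0ℚ))
         := (B :* P) :* ((k :+ k :* e) :* u₁) :+ (:- (B :* c :* ((u₁ :- u₀) :* P)) :- B :* k :* e :* (u₁ :* P))) refl k e B c P u₀ u₁ ⟩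
  (B * P) * ((k + k * e) * u₁) + (- (B * c * ((u₁ - u₀) * P)) - B * k * e * (u₁ * P))
    ≡⟨ cong₂ (λ s t → (B * P) * ((k + k * e) * u₁) + (- (B * c * s) - B * k * e * t)) Δ₀ value₁ ⟩
  (B * P) * ((k + k * e) * u₁) + (- (B * c * e) - B * k * e * (P + e * Y))
    ≡⟨ solve 7 (λ k e B c P u₁ Y → (B :* P) :* ((k :+ k :* e) :* u₁) :+ (:- (B :* c :* e) :- B :* k :* e :* (P :+ e :* Y))
         := (B :* P) :* ((k :+ k :* e) :* u₁) :+ (:- e) :* (k :* (B :* P) :+ (k :* e :* B) :* Y :+ B :* c)) refl k e B c P u₁ Y ⟩
  (B * P) * ((k + k * e) * u₁) + (- e) * (k * (B * P) + (k * e * B) * Y + B * c)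
    ≡⟨ cong (λ t → (B * P) * ((k + k * e) * u₁) + (- e) * t) (sym 0≡b′) ⟩
  (B * P) * ((k + k * e) * u₁) + (- e) * 0ℚ
    ≡⟨ solve 2 (λ a e → a :+ (:- e) :* con 0ℚ := a) refl ((B * P) * ((k + k * e) * u₁)) e ⟩
  (B * P) * ((k + k * e) * u₁) ∎
  where open ≡-Reasoning

difference-ratio : ∀ (r B e P Δ₁ Δ₂ : ℚ) → r * B ≡ 1ℚ → P ≢ 0ℚ → Δ₂ * (B * P) ≡ e → Δ₁ * P ≡ e → Δ₂ ≡ r * Δ₁
difference-ratio r B e P Δ₁ Δ₂ rB≡1 P≢0 Δ₂BP≡e Δ₁P≡e = begin
  Δ₂              ≡⟨ solve 3 (λ r B x → x := (r :* B) :* x :+ (con 1ℚ :- r :* B) :* x) refl r B Δ₂ ⟩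
  (r * B) * Δ₂ + (1ℚ - r * B) * Δ₂  ≡⟨ cong (λ t → (r * B) * Δ₂ + (1ℚ - t) * Δ₂) rB≡1 ⟩
  (r * B) * Δ₂ + (1ℚ - 1ℚ) * Δ₂     ≡⟨ solve 3 (λ r B x → (r :* B) :* x :+ (con 1ℚ :- con 1ℚ) :* x := r :* (B :* x)) refl r B Δ₂ ⟩
  r * (B * Δ₂)    ≡⟨ cong (r *_) (*-cancelˡ-≢0 P≢0 (begin
                       P * (B * Δ₂)  ≡⟨ solve 3 (λ P B x → P :* (B :* x) := x :* (B :* P)) refl P B Δ₂ ⟩
                       Δ₂ * (B * P)  ≡⟨ trans Δ₂BP≡e (sym Δ₁P≡e) ⟩
                       Δ₁ * P        ≡⟨ ℚP.*-comm Δ₁ P ⟩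
                       P * Δ₁        ∎)) ⟩
  r * Δ₁          ∎
  where open ≡-Reasoning

module ClassicalDRG {n : ℕ} (Γ : DRG n) (D : ℕ) (b : ℤ) (α β : ℚ)
  (diam : HasDiameter (DRG.graph Γ) D) (3≤D : 3 ≤ D) (cp : ClassicalParameters Γ D b α β) where

  open DRG Γ using (graph; k)
  open DistanceRegular Γ D diam (ℕP.<⇒≤ 3≤D)

  B r : ℚ
  B = ℤ→ℚ b
  r = recipℤ b

  rB≡1 : r * B ≡ 1ℚ
  rB≡1 = recipℤ-inverseˡ b (proj₁ cp)

  B≢0 : B ≢ 0ℚ
  B≢0 = ℤ→ℚ-≢0 b (proj₁ cp)

  [_] : ℕ → ℚ
  [_] = bracket B

  c-classical : ∀ i → i ≤ D → cℚ i ≡ [ i ] * (1ℚ + α * [ i ∸ 1 ])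
  c-classical i i≤D = proj₁ (proj₂ (proj₂ cp) i i≤D)

  b-classical : ∀ i → i ≤ D → bℚ i ≡ ([ D ] - [ i ]) * (β - α * [ i ])
  b-classical i i≤D = proj₂ (proj₂ (proj₂ cp) i i≤D)

  θ : ℚ
  θ = - 1ℚ + bℚ 1 * r

  open StandardSequence θ

  e : ℚ
  e = u 1 - 1ℚ

  -- Bʲ, written so that the recursion of the bracket applies
  P : ℕ → ℚ
  P i = 1ℚ + (B - 1ℚ) * [ i ]

  P-suc : ∀ j → P (suc j) ≡ B * P j
  P-suc j = solve 2 (λ B Y → con 1ℚ :+ (B :- con 1ℚ) :* (con 1ℚ :+ B :* Y) := B :* (con 1ℚ :+ (B :- con 1ℚ) :* Y)) refl B [ j ]

  P≢0 : ∀ j → P j ≢ 0ℚ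
  P≢0 zero    P₀≡0 = ℚP.1≢0 (trans (solve 1 (λ B → con 1ℚ := con 1ℚ :+ (B :- con 1ℚ) :* con 0ℚ) refl B) P₀≡0)
  P≢0 (suc j) = subst (_≢ 0ℚ) (sym (P-suc j)) (*-≢0 B≢0 (P≢0 j))

  θ≡k+ke : θ ≡ kℚ + kℚ * e
  θ≡k+ke = begin
    θ                       ≡⟨ sym k*u₁≡θ ⟩
    kℚ * u 1                ≡⟨ solve 2 (λ k u → k :* u := k :+ k :* (u :- con 1ℚ)) refl kℚ (u 1) ⟩
    kℚ + kℚ * e             ∎
    where open ≡-Reasoning

  b₁-B-kB≡keB : bℚ 1 - B - kℚ * B ≡ kℚ * e * B
  b₁-B-kB≡keB = begin
    bℚ 1 - B - kℚ * B                 ≡⟨ solve 4 (λ b₁ r k B → b₁ :- B :- k :* B := (:- con 1ℚ :+ b₁ :* r :- k) :* B :+ b₁ :* (con 1ℚ :- r :* B)) refl (bℚ 1) r kℚ B ⟩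
    (θ - kℚ) * B + bℚ 1 * (1ℚ - r * B) ≡⟨ cong₂ (λ s t → (s - kℚ) * B + bℚ 1 * (1ℚ - t)) θ≡k+ke rB≡1 ⟩
    (kℚ + kℚ * e - kℚ) * B + bℚ 1 * (1ℚ - 1ℚ)
                                       ≡⟨ solve 4 (λ k e B b₁ → (k :+ k :* e :- k) :* B :+ b₁ :* (con 1ℚ :- con 1ℚ) := k :* e :* B) refl kℚ e B (bℚ 1) ⟩
    kℚ * e * B                         ∎
    where open ≡-Reasoning

  b-identity : ∀ j → suc j ≤ D → bℚ (suc j) ≡ kℚ * (B * P j) + (kℚ * e * B) * [ suc j ] + B * cℚ (suc j)
  b-identity j 1+j≤D = begin
    bℚ (suc j)                                                   ≡⟨ b-classical (suc j) 1+j≤D ⟩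
    ([ D ] - (1ℚ + B * [ j ])) * (β - α * (1ℚ + B * [ j ]))     ≡⟨ b-expansion [ D ] β α B [ j ] ⟩
    ((([ D ] - 0ℚ) * (β - α * 0ℚ)) * P (suc j)
      + ((([ D ] - (1ℚ + B * 0ℚ)) * (β - α * (1ℚ + B * 0ℚ))) - B - (([ D ] - 0ℚ) * (β - α * 0ℚ)) * B) * [ suc j ]
      + B * ([ suc j ] * (1ℚ + α * [ j ])))
      ≡⟨ cong₂ (λ s t → s * P (suc j) + (t - B - s * B) * [ suc j ] + B * ([ suc j ] * (1ℚ + α * [ j ])))
               (sym (b-classical 0 z≤n)) (sym (b-classical 1 (ℕP.≤-trans (s≤s z≤n) 1+j≤D))) ⟩
    kℚ * P (suc j) + (bℚ 1 - B - kℚ * B) * [ suc j ] + B * ([ suc j ] * (1ℚ + α * [ j ]))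
      ≡⟨ cong₂ (λ s t → kℚ * s + t * [ suc j ] + B * ([ suc j ] * (1ℚ + α * [ j ]))) (P-suc j) b₁-B-kB≡keB ⟩
    kℚ * (B * P j) + (kℚ * e * B) * [ suc j ] + B * ([ suc j ] * (1ℚ + α * [ j ]))
      ≡⟨ cong (λ t → kℚ * (B * P j) + (kℚ * e * B) * [ suc j ] + B * t) (sym (c-classical (suc j) 1+j≤D)) ⟩
    kℚ * (B * P j) + (kℚ * e * B) * [ suc j ] + B * cℚ (suc j) ∎
    where open ≡-Reasoning

  a≡k-c-b : ∀ j → suc j ≤ D → aℚ (suc j) ≡ kℚ - cℚ (suc j) - bℚ (suc j)
  a≡k-c-b j 1+j≤D = begin
    aℚ (suc j)                                          ≡⟨ solve 3 (λ a c b → a := (c :+ a :+ b) :- c :- b) refl (aℚ (suc j)) (cℚ (suc j)) (bℚ (suc j)) ⟩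
    cℚ (suc j) + aℚ (suc j) + bℚ (suc j) - cℚ (suc j) - bℚ (suc j) ≡⟨ cong (λ t → t - cℚ (suc j) - bℚ (suc j)) (c+a+b≡k j 1+j≤D) ⟩
    kℚ - cℚ (suc j) - bℚ (suc j)                        ∎
    where open ≡-Reasoning

  -- the differences uⱼ₊₁ − uⱼ = e rʲ are geometric with ratio r = 1/B
  invariant : ∀ j → suc j ≤ D → ((u (suc j) - u j) * P j ≡ e) × (u (suc j) * P j ≡ P j + e * [ suc j ])
  invariant zero _ =
    solve 2 (λ u₁ B → (u₁ :- con 1ℚ) :* (con 1ℚ :+ (B :- con 1ℚ) :* con 0ℚ) := u₁ :- con 1ℚ) refl (u 1) B ,
    solve 2 (λ u₁ B → u₁ :* (con 1ℚ :+ (B :- con 1ℚ) :* con 0ℚ) :=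
                      (con 1ℚ :+ (B :- con 1ℚ) :* con 0ℚ) :+ (u₁ :- con 1ℚ) :* (con 1ℚ :+ B :* con 0ℚ)) refl (u 1) B
  invariant (suc j) 2+j≤D = Δ , value
    where
    1+j≤D : suc j ≤ D
    1+j≤D = ℕP.<⇒≤ 2+j≤D
    recurrence : bℚ (suc j) * u (suc (suc j)) ≡ (kℚ + kℚ * e) * u (suc j) - cℚ (suc j) * u j - (kℚ - cℚ (suc j) - bℚ (suc j)) * u (suc j)
    recurrence = trans (stdSeq-recurrence j 2+j≤D)
                       (cong₂ (λ s t → s * u (suc j) - cℚ (suc j) * u j - t * u (suc j)) θ≡k+ke (a≡k-c-b j 1+j≤D))
    Δ′ : (u (suc (suc j)) - u (suc j)) * (B * P j) ≡ e
    Δ′ = *-cancelˡ-≢0 (ℕ→ℚ-≢0 (b≢0 (suc j) 2+j≤D))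
           (difference-step kℚ e B (cℚ (suc j)) (bℚ (suc j)) (P j) (u j) (u (suc j)) (u (suc (suc j))) [ suc j ]
              recurrence (proj₁ (invariant j 1+j≤D)) (proj₂ (invariant j 1+j≤D)) (b-identity j 1+j≤D))
    Δ : (u (suc (suc j)) - u (suc j)) * P (suc j) ≡ e
    Δ = trans (cong ((u (suc (suc j)) - u (suc j)) *_) (P-suc j)) Δ′
    value : u (suc (suc j)) * P (suc j) ≡ P (suc j) + e * [ suc (suc j) ]
    value = trans (cong (u (suc (suc j)) *_) (P-suc j))
                  (trans (value-step e B (P j) (u (suc j)) (u (suc (suc j))) [ suc j ] Δ′ (proj₂ (invariant j 1+j≤D)))
                         (cong (_+ e * [ suc (suc j) ]) (sym (P-suc j))))

  b_D≡0 : bℚ D ≡ 0ℚ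
  b_D≡0 = trans (b-classical D ℕP.≤-refl) (solve 3 (λ x y z → (x :- x) :* (y :- z :* x) := con 0ℚ) refl [ D ] β α)

  closing : ∀ j → suc j ≡ D → EigenEquation j
  closing j refl = begin
    u j * cℚ D + u D * aℚ D + u (suc D) * bℚ D      ≡⟨ cong₂ (λ s t → u j * cℚ D + u D * s + u (suc D) * t) (a≡k-c-b j ℕP.≤-refl) b_D≡0 ⟩
    u j * cℚ D + u D * (kℚ - cℚ D - bℚ D) + u (suc D) * 0ℚ
                                                    ≡⟨ cong (λ t → u j * cℚ D + u D * (kℚ - cℚ D - t) + u (suc D) * 0ℚ) b_D≡0 ⟩
    u j * cℚ D + u D * (kℚ - cℚ D - 0ℚ) + u (suc D) * 0ℚ
                                                    ≡⟨ solve 2 (λ a b → a :+ b :* con 0ℚ := a) refl (u j * cℚ D + u D * (kℚ - cℚ D - 0ℚ)) (u (suc D)) ⟩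
    u j * cℚ D + u D * (kℚ - cℚ D - 0ℚ)            ≡⟨ *-cancelˡ-≢0 (*-≢0 B≢0 (P≢0 j))
                                                         (closing-step kℚ e B (cℚ D) (P j) (u j) (u D) [ D ]
                                                            (proj₁ (invariant j ℕP.≤-refl)) (proj₂ (invariant j ℕP.≤-refl)) 0≡b_D) ⟩
    (kℚ + kℚ * e) * u D                             ≡⟨ cong (_* u D) (sym θ≡k+ke) ⟩
    θ * u D                                          ∎
    where
    open ≡-Reasoning
    0≡b_D : 0ℚ ≡ kℚ * (B * P j) + (kℚ * e * B) * [ D ] + B * cℚ D
    0≡b_D = trans (sym b_D≡0) (b-identity j ℕP.≤-refl)

  θ≢k : θ ≢ kℚ
  θ≢k θ≡k = ℕP.<⇒≱ (ℕ≡ℤ*ℕ⇒≤ b (DRG.b Γ 1) (suc k) (proj₁ cp) b₁≡B[1+k]) b₁≤k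
    where
    open ≡-Reasoning
    b₁≤k : DRG.b Γ 1 ≤ k
    b₁≤k = subst (DRG.b Γ 1 ≤_) (ℕ→ℚ-injective (begin
      ℕ→ℚ (DRG.c Γ 1 ℕ.+ DRG.a Γ 1 ℕ.+ DRG.b Γ 1)   ≡⟨ trans (ℕ→ℚ-+ (DRG.c Γ 1 ℕ.+ DRG.a Γ 1) (DRG.b Γ 1)) (cong (_+ bℚ 1) (ℕ→ℚ-+ (DRG.c Γ 1) (DRG.a Γ 1))) ⟩
      cℚ 1 + aℚ 1 + bℚ 1                             ≡⟨ c+a+b≡k 0 (ℕP.≤-trans (s≤s z≤n) 3≤D) ⟩
      kℚ                                             ∎))
      (ℕP.m≤n+m (DRG.b Γ 1) (DRG.c Γ 1 ℕ.+ DRG.a Γ 1))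
    b₁≡B[1+k] : ℕ→ℚ (DRG.b Γ 1) ≡ B * ℕ→ℚ (suc k)
    b₁≡B[1+k] = begin
      bℚ 1                                           ≡⟨ solve 3 (λ b₁ B k → b₁ := (b₁ :- B :- k :* B) :+ B :* (con 1ℚ :+ k)) refl (bℚ 1) B kℚ ⟩
      (bℚ 1 - B - kℚ * B) + B * (1ℚ + kℚ)           ≡⟨ cong (λ t → t + B * (1ℚ + kℚ)) b₁-B-kB≡keB ⟩
      kℚ * e * B + B * (1ℚ + kℚ)                     ≡⟨ cong (λ t → t * B + B * (1ℚ + kℚ)) ke≡0 ⟩
      0ℚ * B + B * (1ℚ + kℚ)                         ≡⟨ solve 2 (λ k B → con 0ℚ :* B :+ B :* (con 1ℚ :+ k) := B :* (con 1ℚ :+ k)) refl kℚ B ⟩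
      B * (1ℚ + kℚ)                                  ≡⟨ cong (B *_) (sym (ℕ→ℚ-+ 1 k)) ⟩
      B * ℕ→ℚ (suc k)                                ∎
      where
      ke≡0 : kℚ * e ≡ 0ℚ
      ke≡0 = begin
        kℚ * e               ≡⟨ solve 2 (λ k x → k :* x := (k :+ k :* x) :- k) refl kℚ e ⟩
        (kℚ + kℚ * e) - kℚ   ≡⟨ cong (_- kℚ) (trans (sym θ≡k+ke) θ≡k) ⟩
        kℚ - kℚ              ≡⟨ ℚP.+-inverseʳ kℚ ⟩
        0ℚ                   ∎

  e≢0 : e ≢ 0ℚ
  e≢0 e≡0 = θ≢k (trans θ≡k+ke (trans (cong (λ t → kℚ + kℚ * t) e≡0) (solve 1 (λ k → k :+ k :* con 0ℚ := k) refl kℚ)))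

  classical-recurrence : ∀ j → suc j ≤ D → u (suc j) ≡ r * u j + (u 1 - r)
  classical-recurrence zero    _ = solve 2 (λ u₁ r → u₁ := r :* con 1ℚ :+ (u₁ :- r)) refl (u 1) r
  classical-recurrence (suc j) 2+j≤D = begin
    u (suc (suc j))                              ≡⟨ solve 2 (λ a b → a := (a :- b) :+ b) refl (u (suc (suc j))) (u (suc j)) ⟩
    (u (suc (suc j)) - u (suc j)) + u (suc j)    ≡⟨ cong (_+ u (suc j)) ratio ⟩
    r * (u (suc j) - u j) + u (suc j)            ≡⟨ cong (λ t → r * (t - u j) + t) (classical-recurrence j 1+j≤D) ⟩
    r * ((r * u j + (u 1 - r)) - u j) + (r * u j + (u 1 - r))
                                                  ≡⟨ solve 3 (λ r u₀ u₁ → r :* ((r :* u₀ :+ (u₁ :- r)) :- u₀) :+ (r :* u₀ :+ (u₁ :- r))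
                                                                       := r :* (r :* u₀ :+ (u₁ :- r)) :+ (u₁ :- r)) refl r (u j) (u 1) ⟩
    r * (r * u j + (u 1 - r)) + (u 1 - r)        ≡⟨ cong (λ t → r * t + (u 1 - r)) (sym (classical-recurrence j 1+j≤D)) ⟩
    r * u (suc j) + (u 1 - r)                    ∎
    where
    open ≡-Reasoning
    1+j≤D : suc j ≤ D
    1+j≤D = ℕP.<⇒≤ 2+j≤D
    ratio : u (suc (suc j)) - u (suc j) ≡ r * (u (suc j) - u j)
    ratio = difference-ratio r B e (P j) _ _ rB≡1 (P≢0 j)
              (trans (cong ((u (suc (suc j)) - u (suc j)) *_) (sym (P-suc j))) (proj₁ (invariant (suc j) 2+j≤D)))
              (proj₁ (invariant j 1+j≤D))

  bracket-r : ∀ i → i ≤ D → bracket r i * e ≡ u i - 1ℚ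
  bracket-r zero    _ = solve 1 (λ e → con 0ℚ :* e := con 1ℚ :- con 1ℚ) refl e
  bracket-r (suc j) 1+j≤D = begin
    (1ℚ + r * bracket r j) * e   ≡⟨ solve 3 (λ r x e → (con 1ℚ :+ r :* x) :* e := e :+ r :* (x :* e)) refl r (bracket r j) e ⟩
    e + r * (bracket r j * e)    ≡⟨ cong (λ t → e + r * t) (bracket-r j (ℕP.<⇒≤ 1+j≤D)) ⟩
    e + r * (u j - 1ℚ)           ≡⟨ solve 3 (λ u₁ r u₀ → (u₁ :- con 1ℚ) :+ r :* (u₀ :- con 1ℚ) := (r :* u₀ :+ (u₁ :- r)) :- con 1ℚ) refl (u 1) r (u j) ⟩
    (r * u j + (u 1 - r)) - 1ℚ   ≡⟨ cong (_- 1ℚ) (sym (classical-recurrence j 1+j≤D)) ⟩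
    u (suc j) - 1ℚ               ∎
    where open ≡-Reasoning

  open Closed closing

  classical-type : ClassicalType Γ D b θ
  classical-type = (u-column , (y₀ , u-column-at-y₀) , column-eigenvector y₀) , θ≢k , (u 1 - r) , classical
    where
    u-column : Fin n → ℚ
    u-column z = u (d y₀ z)
    u-column-at-y₀ : u-column y₀ ≢ 0ℚ
    u-column-at-y₀ u₀≡0 = ℚP.1≢0 (trans (cong u (sym (dist-refl y₀))) u₀≡0)
    classical : ∀ i → 1 ≤ i → i ≤ D → u i ≡ r * u (i ∸ 1) + (u 1 - r)
    classical (suc j) _ 1+j≤D = classical-recurrence j 1+j≤D

  private
    e⁻¹ : ℚ
    e⁻¹ = (1/ e) {{ℚ.≢-nonZero e≢0}}

    ee⁻¹≡1 : e * e⁻¹ ≡ 1ℚ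
    ee⁻¹≡1 = ℚP.*-inverseʳ e {{ℚ.≢-nonZero e≢0}}

    e⁻¹≢0 : e⁻¹ ≢ 0ℚ
    e⁻¹≢0 e⁻¹≡0 = ℚP.1≢0 (trans (sym ee⁻¹≡1) (trans (cong (e *_) e⁻¹≡0) (ℚP.*-zeroʳ e)))

  qDist≡ : ∀ x y → qDistMatrix graph b x y ≡ e⁻¹ * (M x y - 1ℚ)
  qDist≡ x y = begin
    bracket r m                 ≡⟨ solve 3 (λ β e e⁻¹ → β := (β :* e) :* e⁻¹ :+ β :* (con 1ℚ :- e :* e⁻¹)) refl (bracket r m) e e⁻¹ ⟩
    (bracket r m * e) * e⁻¹ + bracket r m * (1ℚ - e * e⁻¹)
                                ≡⟨ cong₂ (λ s t → s * e⁻¹ + bracket r m * (1ℚ - t)) (bracket-r m (dist-≤-D x y)) ee⁻¹≡1 ⟩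
    (u m - 1ℚ) * e⁻¹ + bracket r m * (1ℚ - 1ℚ)
                                ≡⟨ solve 3 (λ a e⁻¹ β → a :* e⁻¹ :+ β :* (con 1ℚ :- con 1ℚ) := e⁻¹ :* a) refl (u m - 1ℚ) e⁻¹ (bracket r m) ⟩
    e⁻¹ * (u m - 1ℚ)            ∎
    where
    open ≡-Reasoning
    m = d x y

  three-eigenvalues : ExactlyThreeEigenvaluesOneZero (qDistMatrix graph b)
  three-eigenvalues = exactlyThreeEigenvaluesOneZero 0<κ x₀ z₁ z₂ diagonal≢0 (off-x₀ d₁) (off-x₀ d₂) u₁≢u₂
    where
    z₁ z₂ : Fin n
    z₁ = vertex-at 0 (ℕP.≤-trans (s≤s z≤n) 3≤D) .proj₁
    z₂ = vertex-at 1 (ℕP.≤-trans (s≤s (s≤s z≤n)) 3≤D) .proj₁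
    d₁ : d x₀ z₁ ≡ 1
    d₁ = vertex-at 0 (ℕP.≤-trans (s≤s z≤n) 3≤D) .proj₂
    d₂ : d x₀ z₂ ≡ 2
    d₂ = vertex-at 1 (ℕP.≤-trans (s≤s (s≤s z≤n)) 3≤D) .proj₂
    open ScaledIdempotent M κ M-sym (M-rowSum θ≢k) M²≡κM
    open Shifted e⁻¹ e⁻¹≢0 (qDistMatrix graph b) qDist≡
    0<κ : 0ℚ ℚ.< κ
    0<κ = ℚP.<-≤-trans (ℚP.positive⁻¹ 1ℚ) 1≤κ
    diagonal≢0 : M x₀ x₀ ≢ 0ℚ
    diagonal≢0 = subst (λ t → u t ≢ 0ℚ) (sym (dist-refl x₀)) ℚP.1≢0
    off-x₀ : ∀ {z i} → d x₀ z ≡ suc i → z ≢ x₀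
    off-x₀ {z} dz z≡x₀ = ℕP.1+n≢0 (trans (sym dz) (trans (cong (d x₀) z≡x₀) (dist-refl x₀)))
    u₁≢u₂ : M z₁ x₀ ≢ M z₂ x₀
    u₁≢u₂ M₁≡M₂ = e≢0 (begin
      e                          ≡⟨ sym (proj₁ (invariant 1 (ℕP.≤-trans (s≤s (s≤s z≤n)) 3≤D))) ⟩
      (u 2 - u 1) * P 1          ≡⟨ cong (λ t → (u 2 - t) * P 1) u₁≡u₂ ⟩
      (u 2 - u 2) * P 1          ≡⟨ solve 2 (λ a p → (a :- a) :* p := con 0ℚ) refl (u 2) (P 1) ⟩
      0ℚ                         ∎)
      where
      open ≡-Reasoning
      u₁≡u₂ : u 1 ≡ u 2
      u₁≡u₂ = begin
        u 1           ≡⟨ cong u (sym (trans (dist-sym z₁ x₀) d₁)) ⟩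
        M z₁ x₀       ≡⟨ M₁≡M₂ ⟩
        M z₂ x₀       ≡⟨ cong u (trans (dist-sym z₂ x₀) d₂) ⟩
        u 2           ∎

lemma4p6 : ∀ {n : ℕ} (Γ : DRG n) (D : ℕ) (b : ℤ) (α β : ℚ) →
    HasDiameter (DRG.graph Γ) D → 3 ≤ D → ClassicalParameters Γ D b α β →
    ClassicalType Γ D b (- 1ℚ + ℕ→ℚ (DRG.b Γ 1) * recipℤ b)
    × ExactlyThreeEigenvaluesOneZero (qDistMatrix (DRG.graph Γ) b)
lemma4p6 Γ D b α β diam 3≤D cp = classical-type , three-eigenvalues
  where open ClassicalDRG Γ D b α β diam 3≤D cp
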